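{- Let $(M_n)_{n\ge1}$, $M_n=(f_n(m,k))_{1\le m,k\le 2n}$, be the Delta sequence, with row sums $f_n(m,\bullet)$ and column sums $f_n(\bullet,k)$ (equal to $0$ for indices outside $[1,2n]$, in particular $f_n(\bullet,0)=0$), and set additionally $f_0(1,\bullet):=1$, $f_0(\bullet,0):=1$ and $f_0(m,\bullet)=0$ for $m\neq1$, $f_0(\bullet,k)=0$ for $k\ne0$. Then for all $n\ge1$: (1) $f_n(1,\bullet)=0$, $f_n(2,\bullet)=\sum_m f_{n-1}(m,\bullet)$, and $f_n(m+2,\bullet)-2f_n(m+1,\bullet)+f_n(m,\bullet)+2f_{n-1}(m,\bullet)=0$ for $1\le m\le 2n-1$; (2) $f_n(\bullet,0)=0$, $f_n(\bullet,1)=\sum_k f_{n-1}(\bullet,k)$, and $f_n(\bullet,k+2)-2f_n(\bullet,k+1)+f_n(\bullet,k)+2f_{n-1}(\bullet,k)=0$ for $0\le k\le 2n-2$.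
   Context: Delta sequence. For $n\ge1$, $M_n=(f_n(m,k))_{1\le m,k\le 2n}$ is a $2n\times 2n$ matrix; by convention $f_n(m,k)=0$ if $(m,k)\notin[1,2n]^2$. Write $f_n(m,\bullet)=\sum_{k=1}^{2n}f_n(m,k)$ and $f_n(\bullet,k)=\sum_{m=1}^{2n}f_n(m,k)$. Let $L_n^{(1)}=\{(m,k):2\le k+1\le m\le 2n-2\}$ and $U_n^{(1)}=\{(m,k):2\le m+1\le k\le 2n-2\}$. The Delta sequence is the unique sequence $(M_n)_{n\ge1}$ of matrices with nonnegative integer entries such that $M_1=\begin{pmatrix}0&0\\1&0\end{pmatrix}$ and, for every $n\ge2$: (a) $f_n(m,m)=0$ for all $m$; (b) $f_n(m+2,k)-2f_n(m+1,k)+f_n(m,k)+2f_{n-1}(m,k)=0$ for $(m,k)\in L_n^{(1)}$; (c) $f_n(m,k+2)-2f_n(m,k+1)+f_n(m,k)+2f_{n-1}(m,k)=0$ for $(m,k)\in U_n^{(1)}$; (d) column $2n$ of $M_n$ is zero, and column $2n-1$ is $(f_{n-1}(1,\bullet),\dots,f_{n-1}(2n-2,\bullet),0,0)$ read top to bottom; (e) row $2n$ of $M_n$ is $(f_{n-1}(1,\bullet),\dots,f_{n-1}(2n-2,\bullet),0,0)$ read left to right, and row $2n-1$ is $(f_{n-1}(1,\bullet)+f_{n-1}(\bullet,1),\dots,f_{n-1}(2n-2,\bullet)+f_{n-1}(\bullet,2n-2),0,0)$. (These conditions determine the sequence uniquely.) -}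

module Defs where

open import Data.Nat using (ℕ; zero; suc; _+_; _*_; _∸_; _≤_; _<_)
open import Data.Nat.Base using (_≡ᵇ_)
open import Data.Bool using (if_then_else_)
open import Data.Fin using (Fin)
import Data.Fin as Fin
open import Data.Maybe using (Maybe; just; nothing)
import Data.Maybe as Maybe
open import Data.Integer using (ℤ; +_) renaming (_+_ to _+ℤ_; _-_ to _-ℤ_; _*_ to _*ℤ_)
open import Data.Product using (_×_)
open import Relation.Binary.PropositionalEquality using (_≡_)

-- A sequence of matrices: M n is a 2n × 2n matrix with entries in ℕ
-- (nonnegative integers), indexed by Fin (2n) (0-based internally).
MatSeq : Set
MatSeq = (n : ℕ) → Fin (2 * n) → Fin (2 * n) → ℕ

toFin : ℕ → (N : ℕ) → Maybe (Fin N)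
toFin i       zero    = nothing
toFin zero    (suc N) = just Fin.zero
toFin (suc i) (suc N) = Maybe.map Fin.suc (toFin i N)

-- f_n(m,k) with 1-based indices; equals 0 if (m,k) ∉ [1,2n]².
entry : MatSeq → ℕ → ℕ → ℕ → ℕ
entry M n zero    k       = 0
entry M n (suc m) zero    = 0
entry M n (suc m) (suc k) with toFin m (2 * n) | toFin k (2 * n)
... | just a | just b = M n a b
... | _      | _      = 0

Σ1 : ℕ → (ℕ → ℕ) → ℕ
Σ1 zero    g = 0
Σ1 (suc N) g = Σ1 N g + g (suc N)

Σ0 : ℕ → (ℕ → ℕ) → ℕ
Σ0 zero    g = g 0
Σ0 (suc N) g = Σ0 N g + g (suc N)

rowSum : MatSeq → ℕ → ℕ → ℕ
rowSum M n m = Σ1 (2 * n) (λ k → entry M n m k)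

colSum : MatSeq → ℕ → ℕ → ℕ
colSum M n k = Σ1 (2 * n) (λ m → entry M n m k)

rowSum' : MatSeq → ℕ → ℕ → ℕ
rowSum' M zero    m = if m ≡ᵇ 1 then 1 else 0
rowSum' M (suc n) m = rowSum M (suc n) m

colSum' : MatSeq → ℕ → ℕ → ℕ
colSum' M zero    k = if k ≡ᵇ 0 then 1 else 0
colSum' M (suc n) k = colSum M (suc n) k

-- Σ_m f_n(m,•) and Σ_k f_n(•,k): summed over indices 0..2n+1, which
-- contains the whole support (for n ≥ 1 it is [1,2n]; for n = 0 it is {1} resp. {0}).
totalRow : MatSeq → ℕ → ℕ
totalRow M n = Σ0 (2 * n + 1) (rowSum' M n)

totalCol : MatSeq → ℕ → ℕ
totalCol M n = Σ0 (2 * n + 1) (colSum' M n)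

record IsDelta (M : MatSeq) : Set where
  field
    base11 : entry M 1 1 1 ≡ 0
    base12 : entry M 1 1 2 ≡ 0
    base21 : entry M 1 2 1 ≡ 1
    base22 : entry M 1 2 2 ≡ 0
    diag : ∀ n → 2 ≤ n → ∀ m → entry M n m m ≡ 0
    lower : ∀ n → 2 ≤ n → ∀ m k → 1 ≤ k → k < m → m + 2 ≤ 2 * n →
      (+ entry M n (m + 2) k -ℤ (+ 2) *ℤ (+ entry M n (m + 1) k))
        +ℤ (+ entry M n m k) +ℤ (+ 2) *ℤ (+ entry M (n ∸ 1) m k) ≡ + 0
    upper : ∀ n → 2 ≤ n → ∀ m k → 1 ≤ m → m < k → k + 2 ≤ 2 * n →
      (+ entry M n m (k + 2) -ℤ (+ 2) *ℤ (+ entry M n m (k + 1)))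
        +ℤ (+ entry M n m k) +ℤ (+ 2) *ℤ (+ entry M (n ∸ 1) m k) ≡ + 0
    col2n   : ∀ n → 2 ≤ n → ∀ m → 1 ≤ m → m ≤ 2 * n → entry M n m (2 * n) ≡ 0
    col2n-1 : ∀ n → 2 ≤ n → ∀ m → 1 ≤ m → m + 2 ≤ 2 * n →
      entry M n m (2 * n ∸ 1) ≡ rowSum M (n ∸ 1) m
    col2n-1a : ∀ n → 2 ≤ n → entry M n (2 * n ∸ 1) (2 * n ∸ 1) ≡ 0
    col2n-1b : ∀ n → 2 ≤ n → entry M n (2 * n) (2 * n ∸ 1) ≡ 0
    row2n   : ∀ n → 2 ≤ n → ∀ k → 1 ≤ k → k + 2 ≤ 2 * n →
      entry M n (2 * n) k ≡ rowSum M (n ∸ 1) k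
    row2na  : ∀ n → 2 ≤ n → entry M n (2 * n) (2 * n ∸ 1) ≡ 0
    row2nb  : ∀ n → 2 ≤ n → entry M n (2 * n) (2 * n) ≡ 0
    row2n-1 : ∀ n → 2 ≤ n → ∀ k → 1 ≤ k → k + 2 ≤ 2 * n →
      entry M n (2 * n ∸ 1) k ≡ rowSum M (n ∸ 1) k + colSum M (n ∸ 1) k
    row2n-1a : ∀ n → 2 ≤ n → entry M n (2 * n ∸ 1) (2 * n ∸ 1) ≡ 0
    row2n-1b : ∀ n → 2 ≤ n → entry M n (2 * n ∸ 1) (2 * n) ≡ 0

SecondDiff : (ℕ → ℕ) → (ℕ → ℕ) → ℕ → Set
SecondDiff g h i =
  (+ g (i + 2) -ℤ (+ 2) *ℤ (+ g (i + 1))) +ℤ (+ g i) +ℤ (+ 2) *ℤ (+ h i) ≡ + 0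

module Submission where

-- Write B = M_n, A = M_(n-1), ρ_n(m) = f_n(m,•) and γ_n(k) = f_n(•,k).  The row-sum
-- statements are proved by induction on n together with four structural facts about
-- the matrices, collected in the record Invariant:
--   * palindromy   ρ_n(j) = ρ_n(2n+2-j);
--   * shift        γ_n(k) = ρ_n(k+1)  (column sums are shifted row sums);
--   * symmetry     f_n(m,k) = f_n(k,m) + ρ_(n-1)(m-k) below the diagonal;
--   * a second-difference law for the columns f_n(•,k) strictly above the band k ≤ m+2.
-- The step n-1 → n rests on two general principles about integer sequences: a
-- second-order recurrence with two vanishing boundary values vanishes identically
-- (zeroPropagatesDown/Up), and sums of second differences telescope.  Each fact at
-- level n is obtained by exhibiting a quantity satisfying such a recurrence (built from
-- the defining relations (b)-(e) and the invariant at level n-1) or by summing the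
-- entrywise relation (b) over a row, where the part of the row inside the diagonal band
-- is handled by the near-diagonal identity and the rest telescopes.  The column
-- statements finally follow from the row statements through the shift property.

open import Defs

module Proof where

  open import Data.Nat using (ℕ; zero; suc; z≤n; s≤s)
    renaming (_+_ to _+ℕ_; _≤_ to _≤ℕ_; _<_ to _<ℕ_; _*_ to _*ℕ_; _∸_ to _∸ℕ_)
  import Data.Nat.Properties as ℕₚ
  open import Data.Integer using (ℤ; +_; _+_; _-_; _*_; -_)
  import Data.Integer.Properties as ℤₚ
  open import Data.Integer.Tactic.RingSolver using (solve-∀)
  open import Data.Maybe using (just; nothing)
  open import Data.Product using (_×_; _,_; proj₁; proj₂)
  open import Data.Sum using (_⊎_; inj₁; inj₂)
  open import Data.Empty using (⊥-elim)
  open import Relation.Nullary using (yes; no)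
  open import Relation.Binary.Definitions using (tri<; tri≈; tri>)
  open import Relation.Binary.PropositionalEquality

  pattern suc² x = suc (suc x)

  Σℤ : ℕ → (ℕ → ℤ) → ℤ
  Σℤ zero    g = + 0
  Σℤ (suc N) g = Σℤ N g + g (suc N)

  Σ1-toℤ : ∀ N g → + Σ1 N g ≡ Σℤ N (λ i → + g i)
  Σ1-toℤ zero    g = refl
  Σ1-toℤ (suc N) g = trans (ℤₚ.pos-+ (Σ1 N g) (g (suc N))) (cong (_+ + g (suc N)) (Σ1-toℤ N g))

  Σ0-toℤ : ∀ N g → + Σ0 N g ≡ + g 0 + Σℤ N (λ i → + g i)
  Σ0-toℤ zero    g = sym (ℤₚ.+-identityʳ _)
  Σ0-toℤ (suc N) g = begin
    + (Σ0 N g +ℕ g (suc N))                         ≡⟨ ℤₚ.pos-+ (Σ0 N g) (g (suc N)) ⟩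
    + Σ0 N g + + g (suc N)                          ≡⟨ cong (_+ + g (suc N)) (Σ0-toℤ N g) ⟩
    (+ g 0 + Σℤ N (λ i → + g i)) + + g (suc N)      ≡⟨ ℤₚ.+-assoc (+ g 0) (Σℤ N (λ i → + g i)) (+ g (suc N)) ⟩
    + g 0 + Σℤ (suc N) (λ i → + g i)                ∎
    where open ≡-Reasoning

  Σℤ-cong : ∀ N f g → (∀ i → 1 ≤ℕ i → i ≤ℕ N → f i ≡ g i) → Σℤ N f ≡ Σℤ N g
  Σℤ-cong zero    f g h = refl
  Σℤ-cong (suc N) f g h =
    cong₂ _+_ (Σℤ-cong N f g (λ i a b → h i a (ℕₚ.m≤n⇒m≤1+n b))) (h (suc N) (s≤s z≤n) ℕₚ.≤-refl)

  Σℤ-zero : ∀ N f → (∀ i → 1 ≤ℕ i → i ≤ℕ N → f i ≡ + 0) → Σℤ N f ≡ + 0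
  Σℤ-zero zero    f h = refl
  Σℤ-zero (suc N) f h =
    cong₂ _+_ (Σℤ-zero N f (λ i a b → h i a (ℕₚ.m≤n⇒m≤1+n b))) (h (suc N) (s≤s z≤n) ℕₚ.≤-refl)

  Σℤ-+ : ∀ N f g → Σℤ N (λ i → f i + g i) ≡ Σℤ N f + Σℤ N g
  Σℤ-+ zero    f g = refl
  Σℤ-+ (suc N) f g =
    trans (cong (_+ (f (suc N) + g (suc N))) (Σℤ-+ N f g)) (interchange (Σℤ N f) (Σℤ N g) _ _)
    where
    interchange : ∀ a b c d → (a + b) + (c + d) ≡ (a + c) + (b + d)
    interchange = solve-∀

  Σℤ-* : ∀ N c f → Σℤ N (λ i → c * f i) ≡ c * Σℤ N f
  Σℤ-* zero    c f = sym (ℤₚ.*-zeroʳ c)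
  Σℤ-* (suc N) c f = trans (cong (_+ c * f (suc N)) (Σℤ-* N c f)) (sym (ℤₚ.*-distribˡ-+ c _ _))

  Σℤ-neg : ∀ N f → Σℤ N (λ i → - f i) ≡ - Σℤ N f
  Σℤ-neg zero    f = refl
  Σℤ-neg (suc N) f = trans (cong (_+ - f (suc N)) (Σℤ-neg N f)) (sym (ℤₚ.neg-distrib-+ (Σℤ N f) (f (suc N))))

  Σℤ-extend : ∀ N N' f → N ≤ℕ N' → (∀ i → N <ℕ i → i ≤ℕ N' → f i ≡ + 0) → Σℤ N' f ≡ Σℤ N f
  Σℤ-extend N N' f N≤N' h = subst (λ x → Σℤ x f ≡ Σℤ N f) (ℕₚ.m∸n+n≡m N≤N') (go (N' ∸ℕ N) h')
    where
    h' : ∀ i → N <ℕ i → i ≤ℕ (N' ∸ℕ N) +ℕ N → f i ≡ + 0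
    h' i a b = h i a (subst (i ≤ℕ_) (ℕₚ.m∸n+n≡m N≤N') b)
    go : ∀ t → (∀ i → N <ℕ i → i ≤ℕ t +ℕ N → f i ≡ + 0) → Σℤ (t +ℕ N) f ≡ Σℤ N f
    go zero    z = refl
    go (suc t) z = trans (cong₂ _+_ (go t (λ i a b → z i a (ℕₚ.m≤n⇒m≤1+n b)))
                                    (z (suc (t +ℕ N)) (s≤s (ℕₚ.m≤n+m N t)) ℕₚ.≤-refl))
                         (ℤₚ.+-identityʳ _)

  Σℤ-shift1 : ∀ N f → Σℤ (suc N) f ≡ f 1 + Σℤ N (λ j → f (suc j))
  Σℤ-shift1 zero    f = trans (ℤₚ.+-identityˡ (f 1)) (sym (ℤₚ.+-identityʳ (f 1)))
  Σℤ-shift1 (suc N) f = trans (cong (_+ f (suc (suc N))) (Σℤ-shift1 N f)) (ℤₚ.+-assoc (f 1) _ _)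

  Σℤ-shift2 : ∀ N f → Σℤ (suc (suc N)) (λ k → f (k ∸ℕ 2)) ≡ (f 0 + f 0) + Σℤ N f
  Σℤ-shift2 zero    f = lemma (f 0)
    where
    lemma : ∀ a → (+ 0 + a) + a ≡ (a + a) + + 0
    lemma = solve-∀
  Σℤ-shift2 (suc N) f = trans (cong (_+ f (suc N)) (Σℤ-shift2 N f)) (ℤₚ.+-assoc (f 0 + f 0) _ _)

  Σℤ-threePoints : ∀ j f → (∀ k → 1 ≤ℕ k → k ≤ℕ j → f k ≡ + 0) →
    ∀ t → (∀ k → suc (suc (suc (suc j))) ≤ℕ k → k ≤ℕ t +ℕ suc (suc (suc j)) → f k ≡ + 0) →
    Σℤ (t +ℕ suc (suc (suc j))) f ≡ (f (suc j) + f (suc (suc j))) + f (suc (suc (suc j)))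
  Σℤ-threePoints j f below zero above =
    trans (cong (λ x → ((x + f (suc j)) + f (suc (suc j))) + f (suc (suc (suc j)))) (Σℤ-zero j f below))
          (lemma (f (suc j)) (f (suc (suc j))) (f (suc (suc (suc j)))))
    where
    lemma : ∀ a b c → ((+ 0 + a) + b) + c ≡ (a + b) + c
    lemma = solve-∀
  Σℤ-threePoints j f below (suc t) above =
    trans (cong₂ _+_ (Σℤ-threePoints j f below t (λ k a b → above k a (ℕₚ.m≤n⇒m≤1+n b)))
                     (above _ (s≤s (ℕₚ.m≤n+m _ t)) ℕₚ.≤-refl))
          (ℤₚ.+-identityʳ _)

  Δ² : (ℕ → ℤ) → ℕ → ℤ
  Δ² X i = (X (suc (suc i)) - + 2 * X (suc i)) + X i

  Δ²-from-+2 : ∀ (X Y : ℕ → ℤ) i → ((X (i +ℕ 2) - + 2 * X (i +ℕ 1)) + X i) + + 2 * Y i ≡ + 0 →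
    Δ² X i + + 2 * Y i ≡ + 0
  Δ²-from-+2 X Y i h rewrite ℕₚ.+-comm i 2 | ℕₚ.+-comm i 1 = h

  Δ²-to-+2 : ∀ (X Y : ℕ → ℤ) i → Δ² X i + + 2 * Y i ≡ + 0 →
    ((X (i +ℕ 2) - + 2 * X (i +ℕ 1)) + X i) + + 2 * Y i ≡ + 0
  Δ²-to-+2 X Y i h rewrite ℕₚ.+-comm i 2 | ℕₚ.+-comm i 1 = h

  Σℤ-Δ²-linear : ∀ N (f g h u : ℕ → ℤ) →
    Σℤ N (λ c → ((f c - + 2 * g c) + h c) + + 2 * u c)
      ≡ ((Σℤ N f - + 2 * Σℤ N g) + Σℤ N h) + + 2 * Σℤ N u
  Σℤ-Δ²-linear zero    f g h u = refl
  Σℤ-Δ²-linear (suc N) f g h u =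
    trans (cong (_+ (((f (suc N) - + 2 * g (suc N)) + h (suc N)) + + 2 * u (suc N))) (Σℤ-Δ²-linear N f g h u))
          (lemma (Σℤ N f) (Σℤ N g) (Σℤ N h) (Σℤ N u) (f (suc N)) (g (suc N)) (h (suc N)) (u (suc N)))
    where
    lemma : ∀ a b c d a' b' c' d' →
      (((a - + 2 * b) + c) + + 2 * d) + (((a' - + 2 * b') + c') + + 2 * d')
        ≡ (((a + a') - + 2 * (b + b')) + (c + c')) + + 2 * (d + d')
    lemma = solve-∀

  Σℤ-Δ² : ∀ K X → Σℤ K (Δ² X) ≡ ((X (suc (suc K)) - X (suc K)) - X 2) + X 1
  Σℤ-Δ² zero X = lemma (X 2) (X 1)
    where
    lemma : ∀ a b → + 0 ≡ ((a - b) - a) + b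
    lemma = solve-∀
  Σℤ-Δ² (suc K) X =
    trans (cong (_+ Δ² X (suc K)) (Σℤ-Δ² K X))
          (lemma (X (suc (suc K))) (X (suc K)) (X 2) (X 1) (X (suc (suc (suc K)))))
    where
    lemma : ∀ a b c d e → (((a - b) - c) + d) + ((e - + 2 * a) + b) ≡ ((e - a) - c) + d
    lemma = solve-∀

  zeroPropagatesDown : ∀ (X : ℕ → ℤ) a c →
    (∀ k → a ≤ℕ k → suc (suc k) ≤ℕ suc c → Δ² X k ≡ + 0) →
    (a ≤ℕ c → X c ≡ + 0) → X (suc c) ≡ + 0 → ∀ k → a ≤ℕ k → k ≤ℕ suc c → X k ≡ + 0
  zeroPropagatesDown X a c rec Xc Xc+1 k a≤k k≤c+1 with ℕₚ.m≤n⇒m<n∨m≡n k≤c+1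
  ... | inj₂ refl = Xc+1
  ... | inj₁ k≤c  = proj₁ (go (c ∸ℕ k) k (ℕₚ.m+[n∸m]≡n (ℕₚ.≤-pred k≤c)) a≤k)
    where
    step : ∀ x y z → x ≡ + 0 → y ≡ + 0 → (x - + 2 * y) + z ≡ + 0 → z ≡ + 0
    step x y z refl refl e = trans (sym (ℤₚ.+-identityˡ z)) e
    go : ∀ t k → k +ℕ t ≡ c → a ≤ℕ k → (X k ≡ + 0) × (X (suc k) ≡ + 0)
    go zero    k e a≤k rewrite ℕₚ.+-identityʳ k | e = Xc a≤k , Xc+1
    go (suc t) k e a≤k =
      step _ _ _ (proj₂ ih) (proj₁ ih) (rec k a≤k (s≤s (subst (suc k ≤ℕ_) e' (ℕₚ.m≤m+n (suc k) t)))) , proj₁ ih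
      where
      e' : suc k +ℕ t ≡ c
      e' = trans (sym (ℕₚ.+-suc k t)) e
      ih = go t (suc k) e' (ℕₚ.m≤n⇒m≤1+n a≤k)

  zeroPropagatesUp : ∀ (X : ℕ → ℤ) a b →
    (∀ k → a ≤ℕ k → suc (suc k) ≤ℕ b → Δ² X k ≡ + 0) →
    X a ≡ + 0 → X (suc a) ≡ + 0 → ∀ k → a ≤ℕ k → k <ℕ b → X k ≡ + 0
  zeroPropagatesUp X a b rec Xa Xa+1 k a≤k k<b =
    subst (λ i → X i ≡ + 0) (ℕₚ.m∸n+n≡m a≤k)
      (proj₁ (go (k ∸ℕ a) (subst (_<ℕ b) (sym (ℕₚ.m∸n+n≡m a≤k)) k<b)))
    where
    step : ∀ x y z → z ≡ + 0 → y ≡ + 0 → (x - + 2 * y) + z ≡ + 0 → x ≡ + 0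
    step x y z refl refl e = trans (sym (ℤₚ.+-identityʳ x)) (trans (cong (_+ + 0) (sym (ℤₚ.+-identityʳ x))) e)
    go : ∀ t → suc (t +ℕ a) ≤ℕ b → (X (t +ℕ a) ≡ + 0) × (X (suc (t +ℕ a)) ≡ + 0)
    go zero    _  = Xa , Xa+1
    go (suc t) le =
      let ih = go t (ℕₚ.≤-trans (ℕₚ.n≤1+n _) le)
      in proj₂ ih , step _ _ _ (proj₁ ih) (proj₂ ih) (rec (t +ℕ a) (ℕₚ.m≤n+m a t) le)

  -- A linear combination of vanishing integers vanishes; used together with ring
  -- identities exhibiting a target expression as such a combination.
  vanishingCombination : ∀ (c₁ c₂ c₃ c₄ c₅ : ℤ) {e₁ e₂ e₃ e₄ e₅ : ℤ} →
    e₁ ≡ + 0 → e₂ ≡ + 0 → e₃ ≡ + 0 → e₄ ≡ + 0 → e₅ ≡ + 0 →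
    (((c₁ * e₁ + c₂ * e₂) + c₃ * e₃) + c₄ * e₄) + c₅ * e₅ ≡ + 0
  vanishingCombination c₁ c₂ c₃ c₄ c₅ refl refl refl refl refl = lemma c₁ c₂ c₃ c₄ c₅
    where
    lemma : ∀ c₁ c₂ c₃ c₄ c₅ → (((c₁ * + 0 + c₂ * + 0) + c₃ * + 0) + c₄ * + 0) + c₅ * + 0 ≡ + 0
    lemma = solve-∀

  a≡b+c⇒a-b-c≡0 : ∀ (a b c : ℤ) → a ≡ b + c → (a - b) - c ≡ + 0
  a≡b+c⇒a-b-c≡0 _ b c refl = lemma b c
    where
    lemma : ∀ b c → ((b + c) - b) - c ≡ + 0
    lemma = solve-∀

  a-b-c≡0⇒a≡b+c : ∀ (a b c : ℤ) → (a - b) - c ≡ + 0 → a ≡ b + c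
  a-b-c≡0⇒a≡b+c a b c e = trans (sym (lemma a b c)) (trans (cong (_+ (b + c)) e) (ℤₚ.+-identityˡ (b + c)))
    where
    lemma : ∀ a b c → ((a - b) - c) + (b + c) ≡ a
    lemma = solve-∀

  a≡b+c⇒a-b≡c : ∀ (a b c : ℤ) → a ≡ b + c → a - b ≡ c
  a≡b+c⇒a-b≡c _ b c refl = lemma b c
    where
    lemma : ∀ b c → (b + c) - b ≡ c
    lemma = solve-∀

  a≡b+c⇒b-a≡-c : ∀ (a b c : ℤ) → a ≡ b + c → b - a ≡ - c
  a≡b+c⇒b-a≡-c _ b c refl = lemma b c
    where
    lemma : ∀ b c → b - (b + c) ≡ - c
    lemma = solve-∀

  whenLt : ℕ → ℕ → ℤ → ℤ
  whenLt zero    zero    x = + 0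
  whenLt zero    (suc c) x = x
  whenLt (suc m) zero    x = + 0
  whenLt (suc m) (suc c) x = whenLt m c x

  whenLt-yes : ∀ m c x → m <ℕ c → whenLt m c x ≡ x
  whenLt-yes zero    (suc c) x _       = refl
  whenLt-yes (suc m) (suc c) x (s≤s p) = whenLt-yes m c x p

  whenLt-no : ∀ m c x → c ≤ℕ m → whenLt m c x ≡ + 0
  whenLt-no zero    zero    x _       = refl
  whenLt-no (suc m) zero    x _       = refl
  whenLt-no (suc m) (suc c) x (s≤s p) = whenLt-no m c x p

  whenLt-zero : ∀ m c → whenLt m c (+ 0) ≡ + 0
  whenLt-zero zero    zero    = refl
  whenLt-zero zero    (suc c) = refl
  whenLt-zero (suc m) zero    = refl
  whenLt-zero (suc m) (suc c) = whenLt-zero m c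

  Σ1-zero : ∀ N g → Σ1 N g ≡ 0 → ∀ k → 1 ≤ℕ k → k ≤ℕ N → g k ≡ 0
  Σ1-zero zero    g e k a b = ⊥-elim (ℕₚ.<⇒≱ a b)
  Σ1-zero (suc N) g e k a b with ℕₚ.m≤n⇒m<n∨m≡n b
  ... | inj₁ lt   = Σ1-zero N g (ℕₚ.m+n≡0⇒m≡0 _ e) k a (ℕₚ.≤-pred lt)
  ... | inj₂ refl = ℕₚ.m+n≡0⇒n≡0 (Σ1 N g) e

  Σ0-shift : ∀ K g → g 0 ≡ 0 → g (suc K) ≡ 0 → Σ0 K (λ i → g (suc i)) ≡ Σ0 K g
  Σ0-shift K g g0 gK = begin
    Σ0 K (λ i → g (suc i))                ≡⟨ sym (ℕₚ.+-identityʳ _) ⟩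
    Σ0 K (λ i → g (suc i)) +ℕ 0           ≡⟨ cong (Σ0 K (λ i → g (suc i)) +ℕ_) (sym g0) ⟩
    Σ0 K (λ i → g (suc i)) +ℕ g 0         ≡⟨ rotate K ⟩
    Σ0 K g +ℕ g (suc K)                   ≡⟨ cong (Σ0 K g +ℕ_) gK ⟩
    Σ0 K g +ℕ 0                           ≡⟨ ℕₚ.+-identityʳ _ ⟩
    Σ0 K g                                ∎
    where
    open ≡-Reasoning
    rotate : ∀ K → Σ0 K (λ i → g (suc i)) +ℕ g 0 ≡ Σ0 K g +ℕ g (suc K)
    rotate zero    = ℕₚ.+-comm (g 1) (g 0)
    rotate (suc K) = begin
      (Σ0 K (λ i → g (suc i)) +ℕ g (suc² K)) +ℕ g 0   ≡⟨ ℕₚ.+-assoc (Σ0 K (λ i → g (suc i))) _ _ ⟩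
      Σ0 K (λ i → g (suc i)) +ℕ (g (suc² K) +ℕ g 0)
        ≡⟨ cong (Σ0 K (λ i → g (suc i)) +ℕ_) (ℕₚ.+-comm (g (suc² K)) (g 0)) ⟩
      Σ0 K (λ i → g (suc i)) +ℕ (g 0 +ℕ g (suc² K))   ≡⟨ sym (ℕₚ.+-assoc (Σ0 K (λ i → g (suc i))) _ _) ⟩
      (Σ0 K (λ i → g (suc i)) +ℕ g 0) +ℕ g (suc² K)   ≡⟨ cong (_+ℕ g (suc² K)) (rotate K) ⟩
      (Σ0 K g +ℕ g (suc K)) +ℕ g (suc² K)             ∎

  toFin-outside : ∀ i N → N ≤ℕ i → toFin i N ≡ nothing
  toFin-outside i       zero    _         = refl
  toFin-outside (suc i) (suc N) (s≤s N≤i) rewrite toFin-outside i N N≤i = refl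

  module MatrixSums (M : MatSeq) where

    E : ℕ → ℕ → ℕ → ℤ
    E n m k = + entry M n m k

    ρ : ℕ → ℕ → ℤ
    ρ n m = + rowSum' M n m

    γ : ℕ → ℕ → ℤ
    γ n k = + colSum' M n k

    entry-belowRows : ∀ n m k → 2 *ℕ n <ℕ m → entry M n m k ≡ 0
    entry-belowRows n (suc m) zero    _ = refl
    entry-belowRows n (suc m) (suc k) (s≤s 2n≤m)
      with toFin m (2 *ℕ n) in e | toFin k (2 *ℕ n)
    ... | just a  | _ = case (trans (sym e) (toFin-outside m (2 *ℕ n) 2n≤m))
      where
      case : just a ≡ nothing → _
      case ()
    ... | nothing | _ = refl

    entry-rightOfCols : ∀ n m k → 2 *ℕ n <ℕ k → entry M n m k ≡ 0
    entry-rightOfCols n zero    k       _ = refl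
    entry-rightOfCols n (suc m) (suc k) (s≤s 2n≤k)
      with toFin m (2 *ℕ n) | toFin k (2 *ℕ n) in e
    ... | _       | just a = case (trans (sym e) (toFin-outside k (2 *ℕ n) 2n≤k))
      where
      case : just a ≡ nothing → _
      case ()
    ... | just _  | nothing = refl
    ... | nothing | nothing = refl

    entry-col0 : ∀ n m → entry M n m 0 ≡ 0
    entry-col0 n zero    = refl
    entry-col0 n (suc m) = refl

    ρ-asSum : ∀ n m → ρ (suc n) m ≡ Σℤ (2 *ℕ suc n) (λ k → E (suc n) m k)
    ρ-asSum n m = Σ1-toℤ (2 *ℕ suc n) (λ k → entry M (suc n) m k)

    γ-asSum : ∀ n k → γ (suc n) k ≡ Σℤ (2 *ℕ suc n) (λ m → E (suc n) m k)
    γ-asSum n k = Σ1-toℤ (2 *ℕ suc n) (λ m → entry M (suc n) m k)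

    ρ-at0 : ∀ n → ρ n 0 ≡ + 0
    ρ-at0 zero    = refl
    ρ-at0 (suc n) = trans (ρ-asSum n 0) (Σℤ-zero (2 *ℕ suc n) _ (λ _ _ _ → refl))

    γ-at0 : ∀ n → γ (suc n) 0 ≡ + 0
    γ-at0 n = trans (γ-asSum n 0) (Σℤ-zero (2 *ℕ suc n) _ (λ m _ _ → cong +_ (entry-col0 (suc n) m)))

    ρ-outside : ∀ n m → 2 *ℕ suc n <ℕ m → ρ (suc n) m ≡ + 0
    ρ-outside n m lt = trans (ρ-asSum n m) (Σℤ-zero (2 *ℕ suc n) _ (λ k _ _ → cong +_ (entry-belowRows (suc n) m k lt)))

    γ-outside : ∀ n k → 2 *ℕ suc n <ℕ k → γ (suc n) k ≡ + 0
    γ-outside n k lt = trans (γ-asSum n k) (Σℤ-zero (2 *ℕ suc n) _ (λ m _ _ → cong +_ (entry-rightOfCols (suc n) m k lt)))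

    ρ-outside′ : ∀ n m → suc (suc (2 *ℕ n)) ≤ℕ m → ρ n m ≡ + 0
    ρ-outside′ zero    (suc (suc m)) _ = refl
    ρ-outside′ zero    (suc zero)    (s≤s ())
    ρ-outside′ (suc n) m le = ρ-outside n m (ℕₚ.≤-trans (ℕₚ.n≤1+n _) le)

  module DeltaFacts (M : MatSeq) (D : IsDelta M) where
    open MatrixSums M public
    open IsDelta D

    2≤2+ : ∀ {j} → 2 ≤ℕ suc (suc j)
    2≤2+ = s≤s (s≤s z≤n)

    lowerRecurrence : ∀ j m k → 1 ≤ℕ k → k <ℕ m → suc (suc m) ≤ℕ 2 *ℕ suc (suc j) →
      Δ² (λ i → E (suc (suc j)) i k) m + + 2 * E (suc j) m k ≡ + 0
    lowerRecurrence j m k 1≤k k<m le = Δ²-from-+2 (λ i → E (suc (suc j)) i k) (λ i → E (suc j) i k) m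
      (lower (suc (suc j)) 2≤2+ m k 1≤k k<m (subst (_≤ℕ 2 *ℕ suc (suc j)) (ℕₚ.+-comm 2 m) le))

    upperRecurrence : ∀ j m k → 1 ≤ℕ m → m <ℕ k → suc (suc k) ≤ℕ 2 *ℕ suc (suc j) →
      Δ² (λ i → E (suc (suc j)) m i) k + + 2 * E (suc j) m k ≡ + 0
    upperRecurrence j m k 1≤m m<k le = Δ²-from-+2 (λ i → E (suc (suc j)) m i) (λ i → E (suc j) m i) k
      (upper (suc (suc j)) 2≤2+ m k 1≤m m<k (subst (_≤ℕ 2 *ℕ suc (suc j)) (ℕₚ.+-comm 2 k) le))

    upperRecurrence′ : ∀ j m k → 1 ≤ℕ m → m <ℕ k → suc (suc k) ≤ℕ 2 *ℕ suc j →
      Δ² (λ i → E (suc j) m i) k + + 2 * E j m k ≡ + 0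
    upperRecurrence′ zero m k 1≤m m<k le =
      ⊥-elim (ℕₚ.<⇒≱ (ℕₚ.≤-trans (s≤s 1≤m) m<k) (ℕₚ.≤-trans (ℕₚ.n≤1+n k) (ℕₚ.≤-pred le)))
    upperRecurrence′ (suc j) = upperRecurrence j

    diagonal-zero : ∀ j m → E (suc j) m m ≡ + 0
    diagonal-zero zero    zero                = refl
    diagonal-zero zero    (suc zero)          = cong +_ base11
    diagonal-zero zero    (suc (suc zero))    = cong +_ base22
    diagonal-zero zero    m@(suc (suc (suc _))) = cong +_ (entry-belowRows 1 m m (s≤s (s≤s (s≤s z≤n))))
    diagonal-zero (suc j) m                   = cong +_ (diag (suc (suc j)) 2≤2+ m)

    lastColumn-zero : ∀ j m → E (suc j) m (2 *ℕ suc j) ≡ + 0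
    lastColumn-zero zero    zero                  = refl
    lastColumn-zero zero    (suc zero)            = cong +_ base12
    lastColumn-zero zero    (suc (suc zero))      = cong +_ base22
    lastColumn-zero zero    m@(suc (suc (suc _))) = cong +_ (entry-belowRows 1 m 2 (s≤s (s≤s (s≤s z≤n))))
    lastColumn-zero (suc j) zero                  = refl
    lastColumn-zero (suc j) (suc m) with suc m ℕₚ.≤? 2 *ℕ suc (suc j)
    ... | yes le = cong +_ (col2n (suc (suc j)) 2≤2+ (suc m) (s≤s z≤n) le)
    ... | no  gt = cong +_ (entry-belowRows (suc (suc j)) (suc m) (2 *ℕ suc (suc j)) (ℕₚ.≰⇒> gt))

    penultimateColumn : ∀ j m → 1 ≤ℕ m → m +ℕ 2 ≤ℕ 2 *ℕ suc j → E (suc j) m (2 *ℕ suc j ∸ℕ 1) ≡ ρ j m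
    penultimateColumn zero    m 1≤m le = ⊥-elim (ℕₚ.<⇒≱ 1≤m (ℕₚ.+-cancelʳ-≤ 2 m 0 le))
    penultimateColumn (suc j) m 1≤m le = cong +_ (col2n-1 (suc (suc j)) 2≤2+ m 1≤m le)

    -- The statements proved by induction, for the level p+1 (with previous level p).
    record Invariant (p : ℕ) : Set where
      field
        rowAt1        : ρ (suc p) 1 ≡ + 0
        rowAt2        : ρ (suc p) 2 ≡ + totalRow M p
        rowRecurrence : ∀ m → 1 ≤ℕ m → suc m ≤ℕ 2 *ℕ suc p → Δ² (ρ (suc p)) m + + 2 * ρ p m ≡ + 0
        rowPalindrome : ∀ j → 1 ≤ℕ j → j ≤ℕ suc (2 *ℕ suc p) →
                          ρ (suc p) j ≡ ρ (suc p) (suc (suc (2 *ℕ suc p)) ∸ℕ j)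
        colShift      : ∀ k → γ (suc p) k ≡ ρ (suc p) (suc k)
        lowerSymmetry : ∀ m k → 1 ≤ℕ k → k <ℕ m → m ≤ℕ 2 *ℕ suc p →
                          E (suc p) m k ≡ E (suc p) k m + ρ p (m ∸ℕ k)
        farColumnRecurrence : ∀ m k → 1 ≤ℕ m → suc (suc (suc m)) ≤ℕ k → k ≤ℕ 2 *ℕ suc p →
                          Δ² (λ i → E (suc p) i k) m + + 2 * E p m (k ∸ℕ 2) ≡ + 0

    invariant-base : Invariant 0
    invariant-base = record
      { rowAt1        = ρ11
      ; rowAt2        = ρ12
      ; rowRecurrence = recurrence
      ; rowPalindrome = palindrome
      ; colShift      = shift
      ; lowerSymmetry = symmetry
      ; farColumnRecurrence = λ m k 1≤m m+3≤k k≤2 →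
          ⊥-elim (ℕₚ.<⇒≱ (ℕₚ.≤-trans (s≤s (s≤s (s≤s 1≤m))) m+3≤k) (ℕₚ.≤-trans k≤2 (ℕₚ.n≤1+n 2)))
      }
      where
      ρ11 : ρ 1 1 ≡ + 0
      ρ11 = cong +_ (cong₂ _+ℕ_ (cong (0 +ℕ_) base11) base12)
      ρ12 : ρ 1 2 ≡ + 1
      ρ12 = cong +_ (cong₂ _+ℕ_ (cong (0 +ℕ_) base21) base22)
      recurrence : ∀ m → 1 ≤ℕ m → suc m ≤ℕ 2 → Δ² (ρ 1) m + + 2 * ρ 0 m ≡ + 0
      recurrence (suc zero) _ _ = evaluate (ρ 1 2) (ρ 1 1) ρ12 ρ11
        where
        evaluate : ∀ a b → a ≡ + 1 → b ≡ + 0 → ((+ 0 - + 2 * a) + b) + + 2 * + 1 ≡ + 0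
        evaluate a b refl refl = refl
      recurrence (suc (suc m)) _ (s≤s (s≤s ()))
      palindrome : ∀ j → 1 ≤ℕ j → j ≤ℕ 3 → ρ 1 j ≡ ρ 1 (4 ∸ℕ j)
      palindrome (suc zero)             _ _ = ρ11
      palindrome (suc (suc zero))       _ _ = refl
      palindrome (suc (suc (suc zero))) _ _ = sym ρ11
      palindrome (suc (suc (suc (suc j)))) _ (s≤s (s≤s (s≤s ())))
      shift : ∀ k → γ 1 k ≡ ρ 1 (suc k)
      shift zero                = sym ρ11
      shift (suc zero)          = trans (cong +_ (cong₂ _+ℕ_ (cong (0 +ℕ_) base11) base21)) (sym ρ12)
      shift (suc (suc zero))    = cong +_ (cong₂ _+ℕ_ (cong (0 +ℕ_) base12) base22)
      shift k@(suc (suc (suc _))) =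
        trans (γ-outside 0 k (s≤s (s≤s (s≤s z≤n)))) (sym (ρ-outside 0 (suc k) (s≤s (s≤s (s≤s z≤n)))))
      symmetry : ∀ m k → 1 ≤ℕ k → k <ℕ m → m ≤ℕ 2 → E 1 m k ≡ E 1 k m + ρ 0 (m ∸ℕ k)
      symmetry (suc (suc zero)) (suc zero) _ _ _ =
        trans (cong +_ base21) (cong (_+ + 1) (sym (cong +_ base12)))
      symmetry (suc zero) (suc zero) _ (s≤s ()) _
      symmetry (suc (suc (suc m))) k _ _ (s≤s (s≤s ()))
      symmetry (suc (suc zero)) (suc (suc k)) _ (s≤s (s≤s ())) _

  module InductionStep (M : MatSeq) (D : IsDelta M) (q : ℕ) (I : DeltaFacts.Invariant M D q) where
    open DeltaFacts M D
    open IsDelta D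
    open Invariant I

    p n N' : ℕ
    p  = suc q
    n  = suc p
    N' = 2 *ℕ p

    size : 2 *ℕ n ≡ suc² N'
    size = ℕₚ.*-suc 2 p

    B A : ℕ → ℕ → ℤ
    B = E n
    A = E p

    toSize : ∀ {x} → x ≤ℕ suc² N' → x ≤ℕ 2 *ℕ n
    toSize {x} = subst (x ≤ℕ_) (sym size)

    fromSize : ∀ {x} → x ≤ℕ 2 *ℕ n → x ≤ℕ suc² N'
    fromSize {x} = subst (x ≤ℕ_) size

    +2≤ : ∀ {x y} → suc² x ≤ℕ y → x +ℕ 2 ≤ℕ y
    +2≤ {x} {y} = subst (_≤ℕ y) (ℕₚ.+-comm 2 x)

    B-lastCol : ∀ x → B x (suc² N') ≡ + 0
    B-lastCol x = subst (λ z → B x z ≡ + 0) size (lastColumn-zero p x)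

    B-penultimateCol : ∀ x → 1 ≤ℕ x → suc² x ≤ℕ suc² N' → B x (suc N') ≡ ρ p x
    B-penultimateCol x 1≤x le =
      subst (λ z → B x (z ∸ℕ 1) ≡ ρ p x) size (penultimateColumn p x 1≤x (toSize (+2≤ le)))

    B-lastRow : ∀ c → 1 ≤ℕ c → suc² c ≤ℕ suc² N' → B (suc² N') c ≡ ρ p c
    B-lastRow c 1≤c le = subst (λ z → B z c ≡ ρ p c) size (cong +_ (row2n n 2≤2+ c 1≤c (toSize (+2≤ le))))

    B-penultimateRow : ∀ c → 1 ≤ℕ c → suc² c ≤ℕ suc² N' → B (suc N') c ≡ ρ p c + γ p c
    B-penultimateRow c 1≤c le = subst (λ z → B (z ∸ℕ 1) c ≡ ρ p c + γ p c) size
      (trans (cong +_ (row2n-1 n 2≤2+ c 1≤c (toSize (+2≤ le)))) (ℤₚ.pos-+ (rowSum M p c) (colSum M p c)))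

    B-corner : B (suc² N') (suc N') ≡ + 0
    B-corner = subst (λ z → B z (z ∸ℕ 1) ≡ + 0) size (cong +_ (row2na n 2≤2+))

    B-lower : ∀ m c → 1 ≤ℕ c → c <ℕ m → suc² m ≤ℕ suc² N' → Δ² (λ i → B i c) m + + 2 * A m c ≡ + 0
    B-lower m c 1≤c c<m le = lowerRecurrence q m c 1≤c c<m (toSize le)

    B-upper : ∀ m c → 1 ≤ℕ m → m <ℕ c → suc² c ≤ℕ suc² N' → Δ² (λ i → B m i) c + + 2 * A m c ≡ + 0
    B-upper m c 1≤m m<c le = upperRecurrence q m c 1≤m m<c (toSize le)

    cong-Δ²form : ∀ {a b c d a' b' c' d' : ℤ} → a ≡ a' → b ≡ b' → c ≡ c' → d ≡ d' →
      ((a - + 2 * b) + c) + + 2 * d ≡ ((a' - + 2 * b') + c') + + 2 * d'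
    cong-Δ²form refl refl refl refl = refl

    -- Far above the diagonal, the columns of B obey the law stated in the invariant:
    -- W x = Δ²_m B(·,x) + 2 A(m,x-2) satisfies Δ²W = 0 in x and vanishes at the last two columns.
    farColumnRecurrence-B : ∀ m c → 1 ≤ℕ m → suc (suc² m) ≤ℕ c → c ≤ℕ suc² N' →
      Δ² (λ i → B i c) m + + 2 * A m (c ∸ℕ 2) ≡ + 0
    farColumnRecurrence-B m c 1≤m m+3≤c c≤ = zeroPropagatesDown W (suc (suc² m)) (suc N') rec Wₗ₋₁ Wₗ c m+3≤c c≤
      where
      W : ℕ → ℤ
      W x = Δ² (λ i → B i x) m + + 2 * A m (x ∸ℕ 2)
      -- Δ²W is a combination of (c) for rows m, m+1, m+2 of B and row m of A, and of the
      -- invariant's far-column law at level p.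
      identity : ∀ (b00 b01 b02 b10 b11 b12 b20 b21 b22 a0 a1 a2 a₁ a₂ a' : ℤ) →
        (((((b22 - + 2 * b12) + b02) + + 2 * a2) - + 2 * (((b21 - + 2 * b11) + b01) + + 2 * a1))
          + (((b20 - + 2 * b10) + b00) + + 2 * a0))
        ≡ ((((+ 1 * (((b22 - + 2 * b21) + b20) + + 2 * a₂) + (- + 2) * (((b12 - + 2 * b11) + b10) + + 2 * a₁))
            + + 1 * (((b02 - + 2 * b01) + b00) + + 2 * a2)) + + 2 * (((a2 - + 2 * a1) + a0) + + 2 * a'))
            + (- + 2) * (((a₂ - + 2 * a₁) + a2) + + 2 * a'))
      identity = solve-∀
      rec : ∀ x → suc (suc² m) ≤ℕ x → suc² x ≤ℕ suc² N' → Δ² W x ≡ + 0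
      rec (suc² x) le₁ le₂ = trans
        (identity (B m (suc² x)) (B m (suc (suc² x))) (B m (suc² (suc² x)))
                  (B (suc m) (suc² x)) (B (suc m) (suc (suc² x))) (B (suc m) (suc² (suc² x)))
                  (B (suc² m) (suc² x)) (B (suc² m) (suc (suc² x))) (B (suc² m) (suc² (suc² x)))
                  (A m x) (A m (suc x)) (A m (suc² x)) (A (suc m) (suc² x)) (A (suc² m) (suc² x)) (E q m x))
        (vanishingCombination (+ 1) (- + 2) (+ 1) (+ 2) (- + 2)
          (B-upper (suc² m) (suc² x) (s≤s z≤n) le₁ le₂)
          (B-upper (suc m) (suc² x) (s≤s z≤n) (ℕₚ.≤-trans (ℕₚ.n≤1+n _) le₁) le₂)
          (B-upper m (suc² x) 1≤m (ℕₚ.≤-trans (ℕₚ.n≤1+n _) (ℕₚ.≤-trans (ℕₚ.n≤1+n _) le₁)) le₂)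
          (upperRecurrence′ q m x 1≤m (ℕₚ.≤-pred (ℕₚ.≤-pred le₁)) (ℕₚ.≤-pred (ℕₚ.≤-pred le₂)))
          (farColumnRecurrence m (suc² x) 1≤m le₁ (ℕₚ.≤-pred (ℕₚ.≤-pred le₂))))
      rec (suc zero) (s≤s ()) _
      rec zero       ()       _
      Wₗ₋₁ : suc (suc² m) ≤ℕ suc N' → W (suc N') ≡ + 0
      Wₗ₋₁ le = trans
        (cong-Δ²form (B-penultimateCol (suc² m) (s≤s z≤n) (s≤s le))
                     (B-penultimateCol (suc m) (s≤s z≤n) (ℕₚ.≤-trans (ℕₚ.n≤1+n _) (s≤s le)))
                     (B-penultimateCol m 1≤m (ℕₚ.≤-trans (ℕₚ.n≤1+n _) (ℕₚ.≤-trans (ℕₚ.n≤1+n _) (s≤s le))))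
                     (penultimateColumn q m 1≤m (+2≤ (ℕₚ.≤-pred le))))
        (rowRecurrence m 1≤m (ℕₚ.≤-trans (ℕₚ.n≤1+n _) (ℕₚ.≤-pred le)))
      Wₗ : W (suc² N') ≡ + 0
      Wₗ = cong-Δ²form (B-lastCol (suc² m)) (B-lastCol (suc m)) (B-lastCol m) (lastColumn-zero q m)

    -- Below the diagonal, B(x,c) = B(c,x) + ρ_p(x-c): the defect X satisfies Δ²X = 0 in x
    -- (by (b), (c), the row recurrence and symmetry at level p) and vanishes at the last two rows.
    lowerSymmetry-B : ∀ m c → 1 ≤ℕ c → c <ℕ m → m ≤ℕ suc² N' → B m c ≡ B c m + ρ p (m ∸ℕ c)
    lowerSymmetry-B m c 1≤c c<m m≤ =
      a-b-c≡0⇒a≡b+c (B m c) (B c m) (ρ p (m ∸ℕ c)) (zeroPropagatesDown X (suc c) (suc N') rec Xₗ₋₁ Xₗ m c<m m≤)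
      where
      X : ℕ → ℤ
      X x = (B x c - B c x) - ρ p (x ∸ℕ c)
      identity : ∀ (b0 b1 b2 u0 u1 u2 r0 r1 r2 axc acx r' : ℤ) →
        (((b2 - u2) - r2) - + 2 * ((b1 - u1) - r1)) + ((b0 - u0) - r0)
        ≡ ((((+ 1 * (((b2 - + 2 * b1) + b0) + + 2 * axc) + (- + 1) * (((u2 - + 2 * u1) + u0) + + 2 * acx))
            + (- + 1) * (((r2 - + 2 * r1) + r0) + + 2 * r')) + (- + 2) * ((axc - acx) - r')) + + 0 * + 0)
      identity = solve-∀
      rec : ∀ x → suc c ≤ℕ x → suc² x ≤ℕ suc² N' → Δ² X x ≡ + 0
      rec x c<x le = trans
        (identity (B x c) (B (suc x) c) (B (suc² x) c) (B c x) (B c (suc x)) (B c (suc² x))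
                  (ρ p d) (ρ p (suc x ∸ℕ c)) (ρ p (suc² x ∸ℕ c)) (A x c) (A c x) (ρ q d))
        (vanishingCombination (+ 1) (- + 1) (- + 1) (- + 2) (+ 0)
          (B-lower x c 1≤c c<x le)
          (B-upper c x 1≤c c<x le)
          (trans (cong-Δ²form {c = ρ p d} {d = ρ q d} (cong (ρ p) shift₂) (cong (ρ p) shift₁) refl refl)
                 (rowRecurrence d (ℕₚ.m<n⇒0<n∸m c<x)
                   (ℕₚ.≤-trans (ℕₚ.∸-monoʳ-< {x} {c} {0} 1≤c (ℕₚ.<⇒≤ c<x)) (ℕₚ.≤-pred (ℕₚ.≤-pred le)))))
          (a≡b+c⇒a-b-c≡0 (A x c) (A c x) (ρ q d) (lowerSymmetry x c 1≤c c<x (ℕₚ.≤-pred (ℕₚ.≤-pred le))))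
          refl)
        where
        d = x ∸ℕ c
        shift₁ : suc x ∸ℕ c ≡ suc d
        shift₁ = ℕₚ.+-∸-assoc 1 (ℕₚ.<⇒≤ c<x)
        shift₂ : suc² x ∸ℕ c ≡ suc² d
        shift₂ = trans (ℕₚ.+-∸-assoc 1 (ℕₚ.≤-trans (ℕₚ.<⇒≤ c<x) (ℕₚ.n≤1+n x))) (cong suc shift₁)
      -- penultimate row/column and the invariant's shift and palindromy
      Xₗ₋₁ : suc c ≤ℕ suc N' → X (suc N') ≡ + 0
      Xₗ₋₁ le = a≡b+c⇒a-b-c≡0 (B (suc N') c) (B c (suc N')) (ρ p (suc N' ∸ℕ c)) (begin
        B (suc N') c                      ≡⟨ B-penultimateRow c 1≤c (s≤s le) ⟩
        ρ p c + γ p c                     ≡⟨ cong (λ z → ρ p c + z) (colShift c) ⟩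
        ρ p c + ρ p (suc c)               ≡⟨ cong (λ z → ρ p c + z) (rowPalindrome (suc c) (s≤s z≤n) le) ⟩
        ρ p c + ρ p (suc N' ∸ℕ c)         ≡⟨ cong (_+ ρ p (suc N' ∸ℕ c)) (sym (B-penultimateCol c 1≤c (s≤s le))) ⟩
        B c (suc N') + ρ p (suc N' ∸ℕ c)  ∎)
        where open ≡-Reasoning
      Xₗ : X (suc² N') ≡ + 0
      Xₗ with ℕₚ.m≤n⇒m<n∨m≡n (ℕₚ.≤-pred (ℕₚ.≤-trans c<m m≤))
      ... | inj₁ c<N'+1 = a≡b+c⇒a-b-c≡0 (B (suc² N') c) (B c (suc² N')) (ρ p (suc² N' ∸ℕ c)) (begin
        B (suc² N') c                      ≡⟨ B-lastRow c 1≤c (s≤s c<N'+1) ⟩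
        ρ p c                              ≡⟨ rowPalindrome c 1≤c (ℕₚ.≤-pred (ℕₚ.≤-trans c<m m≤)) ⟩
        ρ p (suc² N' ∸ℕ c)                 ≡⟨ sym (ℤₚ.+-identityˡ _) ⟩
        + 0 + ρ p (suc² N' ∸ℕ c)           ≡⟨ cong (_+ ρ p (suc² N' ∸ℕ c)) (sym (B-lastCol c)) ⟩
        B c (suc² N') + ρ p (suc² N' ∸ℕ c) ∎)
        where open ≡-Reasoning
      ... | inj₂ refl = a≡b+c⇒a-b-c≡0 (B (suc² N') (suc N')) (B (suc N') (suc² N')) (ρ p (suc² N' ∸ℕ suc N')) (begin
        B (suc² N') (suc N')                       ≡⟨ B-corner ⟩
        + 0                                        ≡⟨ sym (trans (cong (ρ p) (ℕₚ.m+n∸n≡m 1 N')) rowAt1) ⟩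
        ρ p (suc² N' ∸ℕ suc N')                    ≡⟨ sym (ℤₚ.+-identityˡ _) ⟩
        + 0 + ρ p (suc² N' ∸ℕ suc N')              ≡⟨ cong (_+ ρ p (suc² N' ∸ℕ suc N')) (sym (B-lastCol (suc N'))) ⟩
        B (suc N') (suc² N') + ρ p (suc² N' ∸ℕ suc N') ∎)
        where open ≡-Reasoning

    nearDiagonal : ℕ → ℤ
    nearDiagonal m = (B m (suc m) + B (suc m) (suc² m)) - + 2 * B m (suc² m)

    nearDiagonal-step : ∀ m → 1 ≤ℕ m → suc (suc² m) ≤ℕ suc² N' → nearDiagonal m ≡ nearDiagonal (suc m)
    nearDiagonal-step m 1≤m le = ℤₚ.i-j≡0⇒i≡j (nearDiagonal m) (nearDiagonal (suc m)) (trans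
        (identity (B m (suc m)) (B m (suc² m)) (B m (suc (suc² m)))
                  (B (suc m) (suc² m)) (B (suc m) (suc (suc² m))) (B (suc² m) (suc (suc² m))) (A m (suc m)))
        (vanishingCombination (+ 1) (- + 1) (+ 0) (+ 0) (+ 0)
          (B-upper m (suc m) 1≤m ℕₚ.≤-refl le)
          (farColumnRecurrence-B m (suc (suc² m)) 1≤m ℕₚ.≤-refl le) refl refl refl))
      where
      identity : ∀ (b01 b02 b03 b12 b13 b23 a : ℤ) →
        ((b01 + b12) - + 2 * b02) - ((b12 + b23) - + 2 * b13)
        ≡ ((((+ 1 * (((b03 - + 2 * b02) + b01) + + 2 * a) + (- + 1) * (((b23 - + 2 * b13) + b03) + + 2 * a))
           + + 0 * + 0) + + 0 * + 0) + + 0 * + 0)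
      identity = solve-∀

    1≤N' : 1 ≤ℕ N'
    1≤N' = subst (1 ≤ℕ_) (sym (ℕₚ.*-suc 2 q)) (s≤s z≤n)

    nearDiagonal-last : nearDiagonal N' ≡ ρ p 2
    nearDiagonal-last = begin
      (B N' (suc N') + B (suc N') (suc² N')) - + 2 * B N' (suc² N')
        ≡⟨ cong₂ (λ u v → (u + v) - + 2 * B N' (suc² N')) (B-penultimateCol N' 1≤N' ℕₚ.≤-refl) (B-lastCol (suc N')) ⟩
      (ρ p N' + + 0) - + 2 * B N' (suc² N')
        ≡⟨ cong (λ u → (ρ p N' + + 0) - + 2 * u) (B-lastCol N') ⟩
      (ρ p N' + + 0) - + 2 * + 0
        ≡⟨ simplify (ρ p N') ⟩
      ρ p N'
        ≡⟨ rowPalindrome N' 1≤N' (ℕₚ.n≤1+n N') ⟩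
      ρ p (suc² N' ∸ℕ N')
        ≡⟨ cong (ρ p) (ℕₚ.m+n∸n≡m 2 N') ⟩
      ρ p 2 ∎
      where
      open ≡-Reasoning
      simplify : ∀ a → (a + + 0) - + 2 * + 0 ≡ a
      simplify = solve-∀

    nearDiagonal-const : ∀ m → 1 ≤ℕ m → suc² m ≤ℕ suc² N' → nearDiagonal m ≡ ρ p 2
    nearDiagonal-const m 1≤m le = go (N' ∸ℕ m) m 1≤m (ℕₚ.m∸n+n≡m (ℕₚ.≤-pred (ℕₚ.≤-pred le)))
      where
      go : ∀ t m → 1 ≤ℕ m → t +ℕ m ≡ N' → nearDiagonal m ≡ ρ p 2
      go zero    m _   refl = nearDiagonal-last
      go (suc t) m 1≤m e    =
        trans (nearDiagonal-step m 1≤m (s≤s (s≤s (subst (suc m ≤ℕ_) e (s≤s (ℕₚ.m≤n+m m t))))))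
              (go t (suc m) (s≤s z≤n) (trans (ℕₚ.+-suc t m) e))

    ρn-asSum : ∀ x → ρ n x ≡ Σℤ (suc² N') (λ c → B x c)
    ρn-asSum x = subst (λ z → ρ n x ≡ Σℤ z (λ c → B x c)) size (ρ-asSum p x)

    γn-asSum : ∀ x → γ n x ≡ Σℤ (suc² N') (λ c → B c x)
    γn-asSum x = subst (λ z → γ n x ≡ Σℤ z (λ c → B c x)) size (γ-asSum p x)

    ρp-asSum : ∀ x → ρ p x ≡ Σℤ (suc² N') (λ c → A x c)
    ρp-asSum x = trans (ρ-asSum q x)
      (sym (Σℤ-extend N' (suc² N') (λ c → A x c) (ℕₚ.≤-trans (ℕₚ.n≤1+n N') (ℕₚ.n≤1+n _))
             (λ c N'<c _ → cong +_ (entry-rightOfCols p x c N'<c))))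

    A-outside : ∀ x c → N' <ℕ c → A x c ≡ + 0
    A-outside x c lt = cong +_ (entry-rightOfCols p x c lt)

    B-outside : ∀ x c → suc² N' <ℕ c → B x c ≡ + 0
    B-outside x c lt = cong +_ (entry-rightOfCols n x c (subst (_<ℕ c) (sym size) lt))

    ρn-outside : ∀ x → suc² N' <ℕ x → ρ n x ≡ + 0
    ρn-outside x lt = ρ-outside p x (subst (_<ℕ x) (sym size) lt)

    ρp-outside : ∀ x → N' <ℕ x → ρ p x ≡ + 0
    ρp-outside = ρ-outside q

    -- The row recurrence for B at an interior row m = j+1 (m+2 ≤ N'+2), by summing (b) over
    -- the columns c.  Write Z c = Δ²_m B(·,c) + 2A(m,c) = (φ c - φ (c-2)) + ψ c with
    -- φ c = 2A(m,c) for c > m: the φ-part telescopes, and ψ vanishes outside the band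
    -- m ≤ c ≤ m+2 (by (b) below it, by the far-column law above it) while its three band
    -- values cancel by symmetry and the near-diagonal identity.
    module InteriorRow (j : ℕ) (le : suc² (suc j) ≤ℕ suc² N') where
      m : ℕ
      m = suc j

      Z φ ψ : ℕ → ℤ
      Z c = Δ² (λ i → B i c) m + + 2 * A m c
      φ c = whenLt m c (+ 2 * A m c)
      ψ c = Z c - (φ c - φ (c ∸ℕ 2))

      ΣZ≡ : Σℤ (suc² N') Z ≡ Δ² (ρ n) m + + 2 * ρ p m
      ΣZ≡ = trans (Σℤ-Δ²-linear (suc² N') (λ c → B (suc² m) c) (λ c → B (suc m) c) (λ c → B m c) (λ c → A m c))
                  (sym (cong-Δ²form (ρn-asSum (suc² m)) (ρn-asSum (suc m)) (ρn-asSum m) (ρp-asSum m)))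

      φ-outside : ∀ c → N' <ℕ c → φ c ≡ + 0
      φ-outside c lt = trans (cong (λ z → whenLt m c (+ 2 * z)) (A-outside m c lt)) (whenLt-zero m c)

      Σ-telescope : Σℤ (suc² N') (λ c → φ c - φ (c ∸ℕ 2)) ≡ + 0
      Σ-telescope = begin
        Σℤ (suc² N') (λ c → φ c - φ (c ∸ℕ 2))
          ≡⟨ Σℤ-+ (suc² N') φ (λ c → - φ (c ∸ℕ 2)) ⟩
        Σℤ (suc² N') φ + Σℤ (suc² N') (λ c → - φ (c ∸ℕ 2))
          ≡⟨ cong (λ z → Σℤ (suc² N') φ + z) (trans (Σℤ-neg (suc² N') (λ c → φ (c ∸ℕ 2))) (cong -_ (Σℤ-shift2 N' φ))) ⟩
        ((Σℤ N' φ + φ (suc N')) + φ (suc² N')) - ((+ 0 + + 0) + Σℤ N' φ)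
          ≡⟨ cong₂ (λ u v → ((Σℤ N' φ + u) + v) - ((+ 0 + + 0) + Σℤ N' φ))
                   (φ-outside (suc N') (ℕₚ.n<1+n N')) (φ-outside (suc² N') (ℕₚ.≤-trans (ℕₚ.n<1+n N') (ℕₚ.n≤1+n _))) ⟩
        ((Σℤ N' φ + + 0) + + 0) - ((+ 0 + + 0) + Σℤ N' φ)
          ≡⟨ cancel (Σℤ N' φ) ⟩
        + 0 ∎
        where
        open ≡-Reasoning
        cancel : ∀ a → ((a + + 0) + + 0) - ((+ 0 + + 0) + a) ≡ + 0
        cancel = solve-∀

      ψ-below : ∀ c → 1 ≤ℕ c → c ≤ℕ j → ψ c ≡ + 0
      ψ-below c 1≤c c≤j = cong₂ _-_ (B-lower m c 1≤c (s≤s c≤j) le)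
        (cong₂ _-_ (whenLt-no m c _ (ℕₚ.m≤n⇒m≤1+n c≤j))
                   (whenLt-no m (c ∸ℕ 2) _ (ℕₚ.≤-trans (ℕₚ.m∸n≤m c 2) (ℕₚ.m≤n⇒m≤1+n c≤j))))

      ψ-above : ∀ c → suc (suc² m) ≤ℕ c → c ≤ℕ suc² N' → ψ c ≡ + 0
      ψ-above (suc² c) le₁ le₂ = trans
        (cong (λ v → Z (suc² c) - v)
          (cong₂ _-_ (whenLt-yes m (suc² c) _ (ℕₚ.≤-trans (ℕₚ.n≤1+n _) (ℕₚ.≤-trans (ℕₚ.n≤1+n _) le₁)))
                     (whenLt-yes m c _ (ℕₚ.≤-pred (ℕₚ.≤-pred le₁)))))
        (trans (simplify (Δ² (λ i → B i (suc² c)) m) (A m (suc² c)) (A m c))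
               (farColumnRecurrence-B m (suc² c) (s≤s z≤n) le₁ le₂))
        where
        simplify : ∀ d a a' → (d + + 2 * a) - (+ 2 * a - + 2 * a') ≡ d + + 2 * a'
        simplify = solve-∀
      ψ-above (suc zero) (s≤s ()) _
      ψ-above zero       ()       _

      -- The band values, after inserting the diagonal zeros, symmetry and row 1 of A.
      band : ∀ (b01 b12 b02 a01 a02 : ℤ) {b20 b10 b00 a00 b21 b11 b22 r1 r2 : ℤ} →
        b00 ≡ + 0 → b11 ≡ + 0 → b22 ≡ + 0 → a00 ≡ + 0 → r1 ≡ + 0 →
        b20 ≡ b02 + r2 → b10 ≡ b01 + r1 → b21 ≡ b12 + r1 → (b01 + b12) - + 2 * b02 ≡ r2 →
        ((((((b20 - + 2 * b10) + b00) + + 2 * a00) - (+ 0 - + 0))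
          + ((((b21 - + 2 * b11) + b01) + + 2 * a01) - (+ 2 * a01 - + 0)))
          + ((((b22 - + 2 * b12) + b02) + + 2 * a02) - (+ 2 * a02 - + 0))) ≡ + 0
      band b01 b12 b02 a01 a02 refl refl refl refl refl refl refl refl refl = cancel b01 b12 b02 a01 a02
        where
        cancel : ∀ b01 b12 b02 a01 a02 →
          (((((((b02 + ((b01 + b12) - + 2 * b02)) - + 2 * (b01 + + 0)) + + 0) + + 2 * + 0) - (+ 0 - + 0))
          + (((((b12 + + 0) - + 2 * + 0) + b01) + + 2 * a01) - (+ 2 * a01 - + 0)))
          + ((((+ 0 - + 2 * b12) + b02) + + 2 * a02) - (+ 2 * a02 - + 0))) ≡ + 0
        cancel = solve-∀

      ψ-band : (ψ m + ψ (suc m)) + ψ (suc² m) ≡ + 0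
      ψ-band = trans
        (cong₂ _+_ (cong₂ _+_
          (cong (λ v → Z m - v) (cong₂ _-_ (whenLt-no m m _ ℕₚ.≤-refl) (whenLt-no m (m ∸ℕ 2) _ (ℕₚ.m∸n≤m m 2))))
          (cong (λ v → Z (suc m) - v) (cong₂ _-_ (whenLt-yes m (suc m) _ ℕₚ.≤-refl) (whenLt-no m j _ (ℕₚ.n≤1+n j)))))
          (cong (λ v → Z (suc² m) - v) (cong₂ _-_ (whenLt-yes m (suc² m) _ (ℕₚ.n≤1+n _)) (whenLt-no m m _ ℕₚ.≤-refl))))
        (band (B m (suc m)) (B (suc m) (suc² m)) (B m (suc² m)) (A m (suc m)) (A m (suc² m))
          (diagonal-zero p m) (diagonal-zero p (suc m)) (diagonal-zero p (suc² m)) (diagonal-zero q m) rowAt1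
          (trans (lowerSymmetry-B (suc² m) m (s≤s z≤n) (ℕₚ.n≤1+n _) le)
                 (cong (λ z → B m (suc² m) + ρ p z) (ℕₚ.m+n∸n≡m 2 m)))
          (trans (lowerSymmetry-B (suc m) m (s≤s z≤n) ℕₚ.≤-refl (ℕₚ.≤-trans (ℕₚ.n≤1+n _) le))
                 (cong (λ z → B m (suc m) + ρ p z) (ℕₚ.m+n∸n≡m 1 m)))
          (trans (lowerSymmetry-B (suc² m) (suc m) (s≤s z≤n) ℕₚ.≤-refl le)
                 (cong (λ z → B (suc m) (suc² m) + ρ p z) (ℕₚ.m+n∸n≡m 1 m)))
          (nearDiagonal-const m (s≤s z≤n) le))

      Σψ : Σℤ (suc² N') ψ ≡ + 0
      Σψ = trans (cong (λ z → Σℤ z ψ) (sym length))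
        (trans (Σℤ-threePoints j ψ ψ-below (N' ∸ℕ m) (λ c le₁ le₂ → ψ-above c le₁ (subst (c ≤ℕ_) length le₂)))
               ψ-band)
        where
        length : (N' ∸ℕ m) +ℕ suc (suc² j) ≡ suc² N'
        length = trans (ℕₚ.+-suc _ (suc² j))
          (cong suc (trans (ℕₚ.+-suc _ m) (cong suc (ℕₚ.m∸n+n≡m (ℕₚ.≤-pred (ℕₚ.≤-pred le))))))

      rowRecurrence-interior : Δ² (ρ n) m + + 2 * ρ p m ≡ + 0
      rowRecurrence-interior = begin
        Δ² (ρ n) m + + 2 * ρ p m                                  ≡⟨ sym ΣZ≡ ⟩
        Σℤ (suc² N') Z                                            ≡⟨ Σℤ-cong (suc² N') Z _ (λ c _ _ → split c) ⟩
        Σℤ (suc² N') (λ c → (φ c - φ (c ∸ℕ 2)) + ψ c)            ≡⟨ Σℤ-+ (suc² N') (λ c → φ c - φ (c ∸ℕ 2)) ψ ⟩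
        Σℤ (suc² N') (λ c → φ c - φ (c ∸ℕ 2)) + Σℤ (suc² N') ψ   ≡⟨ cong₂ _+_ Σ-telescope Σψ ⟩
        + 0                                                       ∎
        where
        open ≡-Reasoning
        split : ∀ c → Z c ≡ (φ c - φ (c ∸ℕ 2)) + ψ c
        split c = lemma (Z c) (φ c - φ (c ∸ℕ 2))
          where
          lemma : ∀ a b → a ≡ b + (a - b)
          lemma = solve-∀

    S : ℤ
    S = Σℤ (suc² N') (ρ p)

    lastColumns : ∀ c → c ≤ℕ suc² N' → (suc² c ≤ℕ suc² N') ⊎ ((c ≡ suc N') ⊎ (c ≡ suc² N'))
    lastColumns c le with ℕₚ.m≤n⇒m<n∨m≡n le
    ... | inj₂ e = inj₂ (inj₂ e)
    ... | inj₁ lt with ℕₚ.m≤n⇒m<n∨m≡n (ℕₚ.≤-pred lt)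
    ... | inj₂ e   = inj₂ (inj₁ e)
    ... | inj₁ lt′ = inj₁ (s≤s lt′)

    ρp-N'+1 : ρ p (suc N') ≡ + 0
    ρp-N'+1 = ρp-outside (suc N') ℕₚ.≤-refl

    ρp-N'+2 : ρ p (suc² N') ≡ + 0
    ρp-N'+2 = ρp-outside (suc² N') (ℕₚ.n≤1+n _)

    ρp-N'+3 : ρ p (suc (suc² N')) ≡ + 0
    ρp-N'+3 = ρp-outside (suc (suc² N')) (ℕₚ.≤-trans (ℕₚ.n≤1+n _) (ℕₚ.n≤1+n _))

    ΣρpN'+1≡S : Σℤ (suc N') (ρ p) ≡ S
    ΣρpN'+1≡S = trans (sym (ℤₚ.+-identityʳ _)) (cong (λ z → Σℤ (suc N') (ρ p) + z) (sym ρp-N'+2))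

    B-lastRow′ : ∀ c → 1 ≤ℕ c → c ≤ℕ suc² N' → B (suc² N') c ≡ ρ p c
    B-lastRow′ c 1≤c le with lastColumns c le
    ... | inj₁ l           = B-lastRow c 1≤c l
    ... | inj₂ (inj₁ refl) = trans B-corner (sym ρp-N'+1)
    ... | inj₂ (inj₂ refl) = trans (B-lastCol (suc² N')) (sym ρp-N'+2)

    B-penultimateRow′ : ∀ c → 1 ≤ℕ c → c ≤ℕ suc² N' → B (suc N') c ≡ ρ p c + ρ p (suc c)
    B-penultimateRow′ c 1≤c le with lastColumns c le
    ... | inj₁ l           = trans (B-penultimateRow c 1≤c l) (cong (λ z → ρ p c + z) (colShift c))
    ... | inj₂ (inj₁ refl) = trans (diagonal-zero p (suc N')) (sym (cong₂ _+_ ρp-N'+1 ρp-N'+2))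
    ... | inj₂ (inj₂ refl) = trans (B-lastCol (suc N')) (sym (cong₂ _+_ ρp-N'+2 ρp-N'+3))

    ρn-N'+2 : ρ n (suc² N') ≡ S
    ρn-N'+2 = trans (ρn-asSum (suc² N')) (Σℤ-cong (suc² N') _ _ B-lastRow′)

    Σρp-shifted : Σℤ (suc² N') (λ c → ρ p (suc c)) ≡ S
    Σρp-shifted = sym (begin
      S                                              ≡⟨ sym (ℤₚ.+-identityʳ S) ⟩
      S + + 0                                        ≡⟨ cong (λ z → S + z) (sym ρp-N'+3) ⟩
      Σℤ (suc (suc² N')) (ρ p)                       ≡⟨ Σℤ-shift1 (suc² N') (ρ p) ⟩
      ρ p 1 + Σℤ (suc² N') (λ c → ρ p (suc c))       ≡⟨ cong (_+ Σℤ (suc² N') (λ c → ρ p (suc c))) rowAt1 ⟩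
      + 0 + Σℤ (suc² N') (λ c → ρ p (suc c))         ≡⟨ ℤₚ.+-identityˡ _ ⟩
      Σℤ (suc² N') (λ c → ρ p (suc c))               ∎)
      where open ≡-Reasoning

    ρn-N'+1 : ρ n (suc N') ≡ S + S
    ρn-N'+1 = begin
      ρ n (suc N')                                   ≡⟨ ρn-asSum (suc N') ⟩
      Σℤ (suc² N') (λ c → B (suc N') c)              ≡⟨ Σℤ-cong (suc² N') _ _ B-penultimateRow′ ⟩
      Σℤ (suc² N') (λ c → ρ p c + ρ p (suc c))       ≡⟨ Σℤ-+ (suc² N') (ρ p) (λ c → ρ p (suc c)) ⟩
      S + Σℤ (suc² N') (λ c → ρ p (suc c))           ≡⟨ cong (λ z → S + z) Σρp-shifted ⟩
      S + S                                          ∎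
      where open ≡-Reasoning

    rowRecurrence-top : Δ² (ρ n) (suc N') + + 2 * ρ p (suc N') ≡ + 0
    rowRecurrence-top = begin
      ((ρ n (suc (suc² N')) - + 2 * ρ n (suc² N')) + ρ n (suc N')) + + 2 * ρ p (suc N')
        ≡⟨ cong-Δ²form (ρn-outside (suc (suc² N')) ℕₚ.≤-refl) ρn-N'+2 ρn-N'+1 ρp-N'+1 ⟩
      ((+ 0 - + 2 * S) + (S + S)) + + 2 * + 0
        ≡⟨ cancel S ⟩
      + 0 ∎
      where
      open ≡-Reasoning
      cancel : ∀ s → ((+ 0 - + 2 * s) + (s + s)) + + 2 * + 0 ≡ + 0
      cancel = solve-∀

    rowRecurrence-B : ∀ m → 1 ≤ℕ m → suc m ≤ℕ suc² N' → Δ² (ρ n) m + + 2 * ρ p m ≡ + 0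
    rowRecurrence-B (suc j) _ le with lastColumns (suc j) (ℕₚ.≤-trans (ℕₚ.n≤1+n _) le)
    ... | inj₁ l           = InteriorRow.rowRecurrence-interior j l
    ... | inj₂ (inj₁ refl) = rowRecurrence-top
    ... | inj₂ (inj₂ refl) = ⊥-elim (ℕₚ.<-irrefl refl le)

    -- Row 1 vanishes: in A since ρ_p(1) = 0 and entries are nonnegative; in B since
    -- (c) with A(1,·) = 0 is a homogeneous recurrence along the row, which vanishes at
    -- the last two columns.
    A-row1 : ∀ c → A 1 c ≡ + 0
    A-row1 zero    = cong +_ (entry-col0 p 1)
    A-row1 (suc c) with suc c ℕₚ.≤? N'
    ... | yes le = cong +_ (Σ1-zero N' (entry M p 1) (ℤₚ.+-injective rowAt1) (suc c) (s≤s z≤n) le)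
    ... | no  gt = A-outside 1 (suc c) (ℕₚ.≰⇒> gt)

    B-row1 : ∀ c → B 1 c ≡ + 0
    B-row1 zero          = cong +_ (entry-col0 n 1)
    B-row1 (suc zero)    = diagonal-zero p 1
    B-row1 (suc² c) with ℕₚ.≤-<-connex (suc² c) (suc² N')
    ... | inj₂ lt = B-outside 1 (suc² c) lt
    ... | inj₁ le = zeroPropagatesDown (B 1) 2 (suc N') rec B1ₗ₋₁ (B-lastCol 1) (suc² c) (s≤s (s≤s z≤n)) le
      where
      rec : ∀ x → 2 ≤ℕ x → suc² x ≤ℕ suc² N' → Δ² (B 1) x ≡ + 0
      rec x 2≤x l = trans (sym (ℤₚ.+-identityʳ _))
        (trans (cong (λ z → Δ² (B 1) x + + 2 * z) (sym (A-row1 x))) (B-upper 1 x (s≤s z≤n) 2≤x l))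
      B1ₗ₋₁ : 2 ≤ℕ suc N' → B 1 (suc N') ≡ + 0
      B1ₗ₋₁ _ = trans (B-penultimateCol 1 (s≤s z≤n) (s≤s (s≤s 1≤N'))) rowAt1

    rowAt1-B : ρ n 1 ≡ + 0
    rowAt1-B = trans (ρn-asSum 1) (Σℤ-zero (suc² N') (B 1) (λ c _ _ → B-row1 c))

    -- Row 2: summing the row recurrence over m = 1, …, N'+1 and telescoping gives
    -- -2S = -S - ρ_n(2), i.e. ρ_n(2) = S, the total of level p.
    totalRow≡S : + totalRow M p ≡ S
    totalRow≡S = begin
      + totalRow M p                                   ≡⟨ Σ0-toℤ (2 *ℕ p +ℕ 1) (rowSum' M p) ⟩
      ρ p 0 + Σℤ (2 *ℕ p +ℕ 1) (ρ p)                  ≡⟨ cong₂ _+_ (ρ-at0 p) (cong (λ z → Σℤ z (ρ p)) (ℕₚ.+-comm N' 1)) ⟩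
      + 0 + Σℤ (suc N') (ρ p)                          ≡⟨ ℤₚ.+-identityˡ _ ⟩
      Σℤ (suc N') (ρ p)                                ≡⟨ ΣρpN'+1≡S ⟩
      S                                                ∎
      where open ≡-Reasoning

    rowAt2-B : ρ n 2 ≡ + totalRow M p
    rowAt2-B = trans (solve (ρ n 2) S telescoped) (sym totalRow≡S)
      where
      Δ²≡ : ∀ m → 1 ≤ℕ m → m ≤ℕ suc N' → Δ² (ρ n) m ≡ - (+ 2 * ρ p m)
      Δ²≡ m 1≤m le = isolate (Δ² (ρ n) m) (ρ p m) (rowRecurrence-B m 1≤m (s≤s le))
        where
        isolate : ∀ x y → x + + 2 * y ≡ + 0 → x ≡ - (+ 2 * y)
        isolate x y e = trans (sym (cancel x y)) (trans (cong (_- (+ 2 * y)) e) (ℤₚ.+-identityˡ _))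
          where
          cancel : ∀ x y → (x + + 2 * y) - + 2 * y ≡ x
          cancel = solve-∀
      telescoped : - (+ 2 * S) ≡ ((+ 0 - S) - ρ n 2) + + 0
      telescoped = begin
        - (+ 2 * S)                                    ≡⟨ cong (λ z → - (+ 2 * z)) (sym ΣρpN'+1≡S) ⟩
        - (+ 2 * Σℤ (suc N') (ρ p))                    ≡⟨ cong -_ (sym (Σℤ-* (suc N') (+ 2) (ρ p))) ⟩
        - Σℤ (suc N') (λ m → + 2 * ρ p m)              ≡⟨ sym (Σℤ-neg (suc N') (λ m → + 2 * ρ p m)) ⟩
        Σℤ (suc N') (λ m → - (+ 2 * ρ p m))            ≡⟨ sym (Σℤ-cong (suc N') _ _ Δ²≡) ⟩
        Σℤ (suc N') (Δ² (ρ n))                         ≡⟨ Σℤ-Δ² (suc N') (ρ n) ⟩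
        ((ρ n (suc (suc² N')) - ρ n (suc² N')) - ρ n 2) + ρ n 1
          ≡⟨ cong₂ (λ u v → ((u - v) - ρ n 2) + ρ n 1) (ρn-outside (suc (suc² N')) ℕₚ.≤-refl) ρn-N'+2 ⟩
        ((+ 0 - S) - ρ n 2) + ρ n 1                    ≡⟨ cong (λ z → ((+ 0 - S) - ρ n 2) + z) rowAt1-B ⟩
        ((+ 0 - S) - ρ n 2) + + 0                      ∎
        where open ≡-Reasoning
      solve : ∀ a s → - (+ 2 * s) ≡ ((+ 0 - s) - a) + + 0 → a ≡ s
      solve a s e = trans (express a s) (trans (cong (λ z → (- z) - s) (sym e)) (simplify s))
        where
        express : ∀ a s → a ≡ (- (((+ 0 - s) - a) + + 0)) - s
        express = solve-∀
        simplify : ∀ s → (- (- (+ 2 * s))) - s ≡ s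
        simplify = solve-∀

    -- Palindromy: X x = ρ_n(x) - ρ_n(N'+4-x) vanishes at 1 and 2, and Δ²X = 0 follows from
    -- the row recurrence at x and at N'+2-x together with palindromy at level p.
    rowPalindrome-B : ∀ j → 1 ≤ℕ j → j ≤ℕ suc (suc² N') → ρ n j ≡ ρ n (suc² (suc² N') ∸ℕ j)
    rowPalindrome-B j 1≤j le with ℕₚ.m≤n⇒m<n∨m≡n le
    ... | inj₂ refl = trans (ρn-outside (suc (suc² N')) ℕₚ.≤-refl)
                            (sym (trans (cong (ρ n) (ℕₚ.m+n∸n≡m 1 (suc (suc² N')))) rowAt1-B))
    ... | inj₁ lt   = ℤₚ.i-j≡0⇒i≡j _ _ (zeroPropagatesUp X 1 (suc (suc² N')) rec X1 X2 j 1≤j lt)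
      where
      X : ℕ → ℤ
      X x = ρ n x - ρ n (suc² (suc² N') ∸ℕ x)
      X1 : X 1 ≡ + 0
      X1 = ℤₚ.i≡j⇒i-j≡0 (trans rowAt1-B (sym (ρn-outside (suc (suc² N')) ℕₚ.≤-refl)))
      X2 : X 2 ≡ + 0
      X2 = ℤₚ.i≡j⇒i-j≡0 (trans rowAt2-B (trans totalRow≡S (sym ρn-N'+2)))
      identity : ∀ (x0 x1 x2 y0 y1 y2 rx ry : ℤ) →
        ((x2 - y0) - + 2 * (x1 - y1)) + (x0 - y2)
        ≡ ((((+ 1 * (((x2 - + 2 * x1) + x0) + + 2 * rx) + (- + 1) * (((y2 - + 2 * y1) + y0) + + 2 * ry))
           + (- + 2) * (rx - ry)) + + 0 * + 0) + + 0 * + 0)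
      identity = solve-∀
      rec : ∀ x → 1 ≤ℕ x → suc² x ≤ℕ suc (suc² N') → Δ² X x ≡ + 0
      rec x 1≤x l = trans
        (identity (ρ n x) (ρ n (suc x)) (ρ n (suc² x))
                  (ρ n (suc² N' ∸ℕ x)) (ρ n (suc (suc² N') ∸ℕ x)) (ρ n (suc² (suc² N') ∸ℕ x)) (ρ p x) (ρ p i))
        (vanishingCombination (+ 1) (- + 1) (- + 2) (+ 0) (+ 0)
          (rowRecurrence-B x 1≤x (ℕₚ.≤-pred l))
          (trans (cong-Δ²form {c = ρ n i} {d = ρ p i} (cong (ρ n) shift₂) (cong (ρ n) shift₁) refl refl)
                 (rowRecurrence-B i (ℕₚ.m<n⇒0<n∸m (ℕₚ.≤-pred l)) (s≤s (ℕₚ.∸-monoʳ-≤ (suc² N') 1≤x))))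
          (ℤₚ.i≡j⇒i-j≡0 (rowPalindrome x 1≤x (ℕₚ.≤-pred (ℕₚ.≤-pred l))))
          refl refl)
        where
        i = suc² N' ∸ℕ x
        x≤ : x ≤ℕ suc² N'
        x≤ = ℕₚ.≤-trans (ℕₚ.n≤1+n x) (ℕₚ.≤-pred l)
        shift₁ : suc (suc² N') ∸ℕ x ≡ suc i
        shift₁ = ℕₚ.+-∸-assoc 1 x≤
        shift₂ : suc² (suc² N') ∸ℕ x ≡ suc² i
        shift₂ = trans (ℕₚ.+-∸-assoc 1 (ℕₚ.≤-trans x≤ (ℕₚ.n≤1+n _))) (cong suc shift₁)

    -- Shift: with τ_c(x) = B(x,c) - B(c,x) and Γ c = Σ_x τ_c(x) = γ_n(c) - ρ_n(c), symmetry
    -- below the diagonal gives Γ 1 = S and Γ(c+1) = Γ c - 2ρ_p(c); combined with the row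
    -- recurrence this yields γ_n(c) = ρ_n(c+1) by induction on c.
    τ : ℕ → ℕ → ℤ
    τ c x = B x c - B c x

    Γ : ℕ → ℤ
    Γ c = Σℤ (suc² N') (τ c)

    γn≡Γ+ρn : ∀ c → γ n c ≡ Γ c + ρ n c
    γn≡Γ+ρn c = begin
      γ n c                                                          ≡⟨ sym (cancel (γ n c) (ρ n c)) ⟩
      (γ n c - ρ n c) + ρ n c                                        ≡⟨ cong (_+ ρ n c) difference ⟩
      Γ c + ρ n c                                                    ∎
      where
      open ≡-Reasoning
      cancel : ∀ a b → (a - b) + b ≡ a
      cancel = solve-∀
      difference : γ n c - ρ n c ≡ Γ c
      difference = begin
        γ n c - ρ n c                                                ≡⟨ cong₂ _-_ (γn-asSum c) (ρn-asSum c) ⟩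
        Σℤ (suc² N') (λ x → B x c) - Σℤ (suc² N') (B c)
          ≡⟨ cong (λ z → Σℤ (suc² N') (λ x → B x c) + z) (sym (Σℤ-neg (suc² N') (B c))) ⟩
        Σℤ (suc² N') (λ x → B x c) + Σℤ (suc² N') (λ x → - B c x)
          ≡⟨ sym (Σℤ-+ (suc² N') (λ x → B x c) (λ x → - B c x)) ⟩
        Γ c                                                          ∎

    τ-below : ∀ x c → 1 ≤ℕ c → c <ℕ x → x ≤ℕ suc² N' → τ c x ≡ ρ p (x ∸ℕ c)
    τ-below x c 1≤c c<x x≤ = a≡b+c⇒a-b≡c (B x c) (B c x) (ρ p (x ∸ℕ c)) (lowerSymmetry-B x c 1≤c c<x x≤)

    τ-above : ∀ x c → 1 ≤ℕ c → c <ℕ x → x ≤ℕ suc² N' → τ x c ≡ - ρ p (x ∸ℕ c)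
    τ-above x c 1≤c c<x x≤ = a≡b+c⇒b-a≡-c (B x c) (B c x) (ρ p (x ∸ℕ c)) (lowerSymmetry-B x c 1≤c c<x x≤)

    τ-shift : ∀ c → 1 ≤ℕ c → c ≤ℕ suc N' → ∀ y → 1 ≤ℕ y → y ≤ℕ suc N' → τ (suc c) (suc y) ≡ τ c y
    τ-shift c 1≤c c≤ y 1≤y y≤ with ℕₚ.<-cmp y c
    ... | tri< y<c _ _ = trans (τ-above (suc c) (suc y) (s≤s z≤n) (s≤s y<c) (s≤s c≤))
                               (sym (τ-above c y 1≤y y<c (ℕₚ.m≤n⇒m≤1+n c≤)))
    ... | tri≈ _ refl _ = trans (ℤₚ.+-inverseʳ (B (suc c) (suc c))) (sym (ℤₚ.+-inverseʳ (B c c)))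
    ... | tri> _ _ c<y = trans (τ-below (suc y) (suc c) (s≤s z≤n) (s≤s c<y) (s≤s y≤))
                               (sym (τ-below y c 1≤c c<y (ℕₚ.m≤n⇒m≤1+n y≤)))

    Γ-step : ∀ c → 1 ≤ℕ c → c ≤ℕ suc N' → Γ (suc c) ≡ (Γ c - ρ p c) - ρ p c
    Γ-step c 1≤c c≤ = begin
      Γ (suc c)                                       ≡⟨ Σℤ-shift1 (suc N') (τ (suc c)) ⟩
      τ (suc c) 1 + Σℤ (suc N') (λ y → τ (suc c) (suc y))
        ≡⟨ cong₂ _+_ (τ-above (suc c) 1 (s≤s z≤n) (s≤s 1≤c) (s≤s c≤)) (Σℤ-cong (suc N') _ _ (τ-shift c 1≤c c≤)) ⟩
      - ρ p c + Σℤ (suc N') (τ c)                     ≡⟨ rearrange (ρ p c) (Σℤ (suc N') (τ c)) (τ c (suc² N')) last ⟩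
      (Γ c - ρ p c) - ρ p c                           ∎
      where
      open ≡-Reasoning
      last : τ c (suc² N') ≡ ρ p c
      last = trans (τ-below (suc² N') c 1≤c (s≤s c≤) ℕₚ.≤-refl) (sym (rowPalindrome c 1≤c c≤))
      rearrange : ∀ r s t → t ≡ r → - r + s ≡ ((s + t) - r) - r
      rearrange r s _ refl = lemma r s
        where
        lemma : ∀ r s → - r + s ≡ ((s + r) - r) - r
        lemma = solve-∀

    Γ-1 : Γ 1 ≡ S
    Γ-1 = begin
      Γ 1                                          ≡⟨ Σℤ-shift1 (suc N') (τ 1) ⟩
      τ 1 1 + Σℤ (suc N') (λ y → τ 1 (suc y))
        ≡⟨ cong₂ _+_ (ℤₚ.+-inverseʳ (B 1 1))
                     (Σℤ-cong (suc N') _ _ (λ y 1≤y y≤ → τ-below (suc y) 1 (s≤s z≤n) (s≤s 1≤y) (s≤s y≤))) ⟩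
      + 0 + Σℤ (suc N') (ρ p)                      ≡⟨ ℤₚ.+-identityˡ _ ⟩
      Σℤ (suc N') (ρ p)                            ≡⟨ ΣρpN'+1≡S ⟩
      S                                            ∎
      where open ≡-Reasoning

    colShift-inside : ∀ c → 1 ≤ℕ c → c ≤ℕ suc² N' → γ n c ≡ ρ n (suc c)
    colShift-inside (suc zero) _ _ = begin
      γ n 1           ≡⟨ γn≡Γ+ρn 1 ⟩
      Γ 1 + ρ n 1     ≡⟨ cong₂ _+_ Γ-1 rowAt1-B ⟩
      S + + 0         ≡⟨ ℤₚ.+-identityʳ S ⟩
      S               ≡⟨ sym (trans rowAt2-B totalRow≡S) ⟩
      ρ n 2           ∎
      where open ≡-Reasoning
    colShift-inside (suc² c) _ le =
      trans (γn≡Γ+ρn (suc² c))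
        (conclude (Γ (suc² c)) (Γ (suc c)) (ρ p (suc c)) (ρ n (suc c)) (ρ n (suc² c)) (ρ n (suc (suc² c)))
          (Γ-step (suc c) (s≤s z≤n) (ℕₚ.≤-pred le))
          (trans (sym (γn≡Γ+ρn (suc c))) (colShift-inside (suc c) (s≤s z≤n) (ℕₚ.≤-trans (ℕₚ.n≤1+n _) le)))
          (rowRecurrence-B (suc c) (s≤s z≤n) le))
      where
      conclude : ∀ g₁ g₀ r a₀ a₁ a₂ → g₁ ≡ (g₀ - r) - r → g₀ + a₀ ≡ a₁ →
        ((a₂ - + 2 * a₁) + a₀) + + 2 * r ≡ + 0 → g₁ + a₁ ≡ a₂
      conclude g₁ g₀ r a₀ a₁ a₂ refl refl e =
        trans (lemma g₀ r a₀ a₂) (trans (cong (λ z → (z * - + 1) + a₂) e) (ℤₚ.+-identityˡ a₂))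
        where
        lemma : ∀ g₀ r a₀ a₂ → ((g₀ - r) - r) + (g₀ + a₀) ≡ ((((a₂ - + 2 * (g₀ + a₀)) + a₀) + + 2 * r) * - + 1) + a₂
        lemma = solve-∀

    colShift-B : ∀ c → γ n c ≡ ρ n (suc c)
    colShift-B zero    = trans (γ-at0 p) (sym rowAt1-B)
    colShift-B (suc c) with ℕₚ.≤-<-connex (suc c) (suc² N')
    ... | inj₁ le = colShift-inside (suc c) (s≤s z≤n) le
    ... | inj₂ lt = trans (γ-outside p (suc c) (subst (_<ℕ suc c) (sym size) lt))
                          (sym (ρn-outside (suc² c) (ℕₚ.≤-trans lt (ℕₚ.n≤1+n _))))

    invariant-step : Invariant p
    invariant-step = record
      { rowAt1        = rowAt1-B
      ; rowAt2        = rowAt2-B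
      ; rowRecurrence = λ m 1≤m le → rowRecurrence-B m 1≤m (fromSize le)
      ; rowPalindrome = subst (λ z → ∀ j → 1 ≤ℕ j → j ≤ℕ suc z → ρ n j ≡ ρ n (suc² z ∸ℕ j)) (sym size) rowPalindrome-B
      ; colShift      = colShift-B
      ; lowerSymmetry = λ m c 1≤c c<m le → lowerSymmetry-B m c 1≤c c<m (fromSize le)
      ; farColumnRecurrence = λ m c 1≤m m+3≤c le → farColumnRecurrence-B m c 1≤m m+3≤c (fromSize le)
      }

  module Conclusion (M : MatSeq) (D : IsDelta M) where
    open DeltaFacts M D

    invariant : ∀ q → Invariant q
    invariant zero    = invariant-base
    invariant (suc q) = InductionStep.invariant-step M D q (invariant q)

    colShift-ℕ : ∀ n k → colSum' M n k ≡ rowSum' M n (suc k)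
    colShift-ℕ zero    k = refl
    colShift-ℕ (suc n) k = ℤₚ.+-injective (Invariant.colShift (invariant n) k)

    totalCol≡totalRow : ∀ n → totalCol M n ≡ totalRow M n
    totalCol≡totalRow n = trans (Σ0-cong {2 *ℕ n +ℕ 1} (colShift-ℕ n))
      (Σ0-shift (2 *ℕ n +ℕ 1) (rowSum' M n) (ℤₚ.+-injective (ρ-at0 n))
        (ℤₚ.+-injective (ρ-outside′ n _ (s≤s (ℕₚ.≤-reflexive (ℕₚ.+-comm 1 (2 *ℕ n)))))))
      where
      Σ0-cong : ∀ {K f g} → (∀ i → f i ≡ g i) → Σ0 K f ≡ Σ0 K g
      Σ0-cong {zero}  h = h 0
      Σ0-cong {suc K} h = cong₂ _+ℕ_ (Σ0-cong {K} h) (h (suc K))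

    rowSum-1 : ∀ q → rowSum' M (suc q) 1 ≡ 0
    rowSum-1 q = ℤₚ.+-injective (Invariant.rowAt1 (invariant q))

    rowSum-2 : ∀ q → rowSum' M (suc q) 2 ≡ totalRow M q
    rowSum-2 q = ℤₚ.+-injective (Invariant.rowAt2 (invariant q))

    rowSum-recurrence : ∀ q m → 1 ≤ℕ m → m ≤ℕ 2 *ℕ suc q ∸ℕ 1 →
      SecondDiff (rowSum' M (suc q)) (rowSum' M q) m
    rowSum-recurrence q m 1≤m le = Δ²-to-+2 (ρ (suc q)) (ρ q) m
      (Invariant.rowRecurrence (invariant q) m 1≤m
        (subst (suc m ≤ℕ_) (sym (ℕₚ.*-suc 2 q)) (s≤s (subst (m ≤ℕ_) (cong (_∸ℕ 1) (ℕₚ.*-suc 2 q)) le))))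

    colSum-0 : ∀ q → colSum' M (suc q) 0 ≡ 0
    colSum-0 q = ℤₚ.+-injective (γ-at0 q)

    colSum-1 : ∀ q → colSum' M (suc q) 1 ≡ totalCol M q
    colSum-1 q = trans (colShift-ℕ (suc q) 1) (trans (rowSum-2 q) (sym (totalCol≡totalRow q)))

    -- The column recurrence at k is the row recurrence at k+1, by the shift property.
    colSum-recurrence : ∀ q k → k ≤ℕ 2 *ℕ suc q ∸ℕ 2 →
      SecondDiff (colSum' M (suc q)) (colSum' M q) k
    colSum-recurrence q k le = Δ²-to-+2 (γ (suc q)) (γ q) k (begin
      Δ² (γ (suc q)) k + + 2 * γ q k
        ≡⟨ cong₂ (λ u v → u + + 2 * v) (cong₂ _+_ (cong₂ (λ a b → a - + 2 * b) (shift (suc² k)) (shift (suc k))) (shift k))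
                                         (cong +_ (colShift-ℕ q k)) ⟩
      Δ² (ρ (suc q)) (suc k) + + 2 * ρ q (suc k)
        ≡⟨ Invariant.rowRecurrence (invariant q) (suc k) (s≤s z≤n) bound ⟩
      + 0 ∎)
      where
      open ≡-Reasoning
      shift : ∀ k → γ (suc q) k ≡ ρ (suc q) (suc k)
      shift = Invariant.colShift (invariant q)
      bound : suc² k ≤ℕ 2 *ℕ suc q
      bound = subst (suc² k ≤ℕ_) (sym (ℕₚ.*-suc 2 q)) (s≤s (s≤s (subst (k ≤ℕ_) (cong (_∸ℕ 2) (ℕₚ.*-suc 2 q)) le)))

open import Data.Nat using (suc; _*_; _∸_; _≤_)
open import Data.Product using (_×_; _,_)
open import Relation.Binary.PropositionalEquality using (_≡_)

mainTheorem13 : (M : MatSeq) → IsDelta M → ∀ n → 1 ≤ n →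
    ((rowSum' M n 1 ≡ 0)
      × (rowSum' M n 2 ≡ totalRow M (n ∸ 1))
      × (∀ m → 1 ≤ m → m ≤ 2 * n ∸ 1 → SecondDiff (rowSum' M n) (rowSum' M (n ∸ 1)) m))
    × ((colSum' M n 0 ≡ 0)
      × (colSum' M n 1 ≡ totalCol M (n ∸ 1))
      × (∀ k → k ≤ 2 * n ∸ 2 → SecondDiff (colSum' M n) (colSum' M (n ∸ 1)) k))
mainTheorem13 M D (suc q) _ =
  (rowSum-1 q , rowSum-2 q , rowSum-recurrence q) , (colSum-0 q , colSum-1 q , colSum-recurrence q)
  where open Proof.Conclusion M D
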